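{- Let $\mathbb{K}$ be a commutative $\mathbb{Q}$-algebra, let $n$ be a positive integer and let $a \in \mathbb{K}[x]$. Then $G^n(a)$ is the unique polynomial in $\mathbb{K}[x]$ of degree less than $n$ which is congruent to $a$ modulo $\Phi_n(x)$ and is congruent to $0$ modulo $x^d-1$ for each proper positive divisor $d$ of $n$.
   Context: $\Phi_n(x)$ denotes the $n$-th cyclotomic polynomial; $[x^s]f$ denotes the coefficient of $x^s$ in $f$. For an integer $l$ and positive integer $n$, the Ramanujan sum is $c_n(l)=\sum_{e\mid n,\ e\mid l}\mu(n/e)\,e$ (an integer, regarded as an element of $\mathbb{K}$). For $a\in\mathbb{K}[x]$ and $i\in\mathbb{Z}$, $G^n_i(a)=\sum_{s\ge 0}[x^s]a\cdot c_n(i-s)$, and $G^n(a)=\frac{1}{n}\sum_{0\le i<n}G^n_i(a)x^i$. -}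

module Defs where

open import Level using (Level; _⊔_)
open import Data.Bool using (Bool; true; false; if_then_else_; _∧_)
open import Data.Nat as ℕ using (ℕ; zero; suc; NonZero; _≤_; _<_)
open import Data.Nat.Divisibility using (_∣_; _∣?_)
open import Data.Nat.Primality using (prime?)
open import Data.Integer as ℤ using (ℤ; +_; ∣_∣)
open import Data.List using (List; []; _∷_; map; foldr; filterᵇ; length; upTo; applyUpTo; replicate; _++_)
open import Data.Product using (Σ; _×_)
open import Relation.Nullary.Decidable using (does)
open import Data.Rational as ℚ using (ℚ)
import Data.Rational.Base as ℚB
open import Algebra.Bundles using (CommutativeRing)
open import Algebra.Morphism.Structures using (module RingMorphisms)

oneTo : ℕ → List ℕ
oneTo n = applyUpTo suc n

squareFactor : ℕ → Bool
squareFactor m = foldr (λ d b → (does (2 ℕ.≤? d) ∧ does ((d ℕ.* d) ∣? m)) Data.Bool.∨ b) false (upTo (suc m))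

numPrimeDivisors : ℕ → ℕ
numPrimeDivisors m = length (filterᵇ (λ p → does (prime? p) ∧ does (p ∣? m)) (upTo (suc m)))

μ : ℕ → ℤ
μ m = if squareFactor m then + 0 else (ℤ.- (+ 1)) ℤ.^ numPrimeDivisors m

-- Ramanujan sum c_n(l) = Σ_{e ∣ n, e ∣ l} μ(n/e) e   (e ranges over positive divisors)
ramanujan : ℕ → ℤ → ℤ
ramanujan n l = foldr ℤ._+_ (+ 0) (map term (upTo n))
  where
  term : ℕ → ℤ
  term k = if does (suc k ∣? n) ∧ does (suc k ∣? ∣ l ∣)
           then μ (n ℕ./ suc k) ℤ.* (+ suc k)
           else + 0

-- Commutative ℚ-algebras: a commutative ring with a ring homomorphism ℚ → K

module _ {c ℓ : Level} (K : CommutativeRing c ℓ) where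
  open CommutativeRing K
  open RingMorphisms ℚB.+-*-rawRing rawRing

  IsℚAlgebraMap : (ℚ → Carrier) → Set ℓ
  IsℚAlgebraMap f = IsRingHomomorphism f

-- Polynomials over a commutative ring K, as coefficient lists
-- (constant coefficient first); equality is coefficientwise, so
-- trailing zeros are irrelevant.

module Poly {c ℓ : Level} (K : CommutativeRing c ℓ) where
  open CommutativeRing K

  Pol : Set c
  Pol = List Carrier

  coeff : Pol → ℕ → Carrier
  coeff []      _       = 0#
  coeff (a ∷ p) zero    = a
  coeff (a ∷ p) (suc s) = coeff p s

  infix 4 _≈ₚ_
  _≈ₚ_ : Pol → Pol → Set ℓ
  p ≈ₚ q = ∀ s → coeff p s ≈ coeff q s

  infixl 6 _+ₚ_ _-ₚ_
  infixl 7 _*ₚ_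
  _+ₚ_ : Pol → Pol → Pol
  []      +ₚ q       = q
  (a ∷ p) +ₚ []      = a ∷ p
  (a ∷ p) +ₚ (b ∷ q) = (a + b) ∷ (p +ₚ q)

  -ₚ_ : Pol → Pol
  -ₚ p = map -_ p

  _-ₚ_ : Pol → Pol → Pol
  p -ₚ q = p +ₚ (-ₚ q)

  _*ₚ_ : Pol → Pol → Pol
  []      *ₚ q = []
  (a ∷ p) *ₚ q = map (a *_) q +ₚ (0# ∷ (p *ₚ q))

  oneₚ : Pol
  oneₚ = 1# ∷ []

  zeroₚ : Pol
  zeroₚ = []

  xPow : ℕ → Pol
  xPow d = replicate d 0# ++ (1# ∷ [])

  xPowMinusOne : ℕ → Pol
  xPowMinusOne d = xPow d -ₚ oneₚ

  prodₚ : List Pol → Pol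
  prodₚ = foldr _*ₚ_ oneₚ

  _∣ₚ_ : Pol → Pol → Set (c ⊔ ℓ)
  m ∣ₚ p = Σ Pol (λ q → p ≈ₚ q *ₚ m)

  Congruent : Pol → Pol → Pol → Set (c ⊔ ℓ)
  Congruent a b m = m ∣ₚ (a -ₚ b)

  DegLt : Pol → ℕ → Set ℓ
  DegLt p n = ∀ s → n ≤ s → coeff p s ≈ 0#

  -- Φ : ℕ → K[x] is the family of cyclotomic polynomials, defined by
  -- the recursion  x^m - 1 = ∏_{d ∣ m, 1 ≤ d ≤ m} Φ_d(x)  for all m ≥ 1
  -- (this determines Φ_m for every m ≥ 1 uniquely).
  IsCyclotomicFamily : (ℕ → Pol) → Set ℓ
  IsCyclotomicFamily Φ =
    ∀ m → 1 ≤ m →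
      xPowMinusOne m ≈ₚ prodₚ (map Φ (filterᵇ (λ d → does (d ∣? m)) (oneTo m)))

  module _ (f : ℚ → Carrier) where
    ιℤ : ℤ → Carrier
    ιℤ z = f (z ℚB./ 1)

    sumK : List Carrier → Carrier
    sumK = foldr _+_ 0#

    Gi : ℕ → Pol → ℤ → Carrier
    Gi n a i = sumK (map (λ s → coeff a s * ιℤ (ramanujan n (i ℤ.- (+ s)))) (upTo (length a)))

    G : (n : ℕ) → .{{NonZero n}} → Pol → Pol
    G n a = map (λ i → f (+ 1 ℚB./ n) * Gi n a (+ i)) (upTo n)

module Submission where

-- Let T = Σ_{i<n} c_n(i) x^i.  As c_n is n-periodic, Σ_{i<n} c_n(i-s) x^i
-- ≡ x^s T mod x^n - 1, so n G^n(a) ≡ a T.  Expanding c_n gives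
-- T = Σ_{e ∣ n} μ(n/e) e P_e with P_e = Σ_{j<n/e} x^{je}; since P_e ≡ n/e
-- mod x^e - 1 and Φ_k ∣ P_e for k ∣ n, k ∤ e, we get T ≡ n mod Φ_n and,
-- by Möbius' identity, T ≡ 0 mod Φ_k for proper divisors k of n.  With n
-- invertible, distinct Φ's are coprime, so x^d - 1 = Π_{k ∣ d} Φ_k divides
-- whatever all the Φ_k divide; a multiple of x^n - 1 of degree < n is 0.

open import Defs
open import Level using (Level)
open import Data.Nat using (ℕ; NonZero; _≤_; _<_)
open import Data.Nat.Divisibility using (_∣_)
open import Data.Product using (_×_)
open import Data.Rational using (ℚ)
open import Algebra.Bundles using (CommutativeRing)

module IntegerSolver {c ℓ} (R : CommutativeRing c ℓ) where
  open import Data.Nat as ℕ using (zero; suc)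
  open import Data.Integer as ℤ using (ℤ; +_; -[1+_]; _⊖_)
  import Data.Integer.Properties as ℤP
  import Data.Nat.Properties as ℕP
  open import Data.Sign as Sign using (Sign)
  open import Relation.Binary.PropositionalEquality as ≡ using (_≡_)
  open import Data.Maybe using (Maybe; just; nothing)
  open import Relation.Nullary using (yes; no)
  import Algebra.Solver.Ring.AlmostCommutativeRing as ACR
  open CommutativeRing R
  open import Relation.Binary.Reasoning.Setoid setoid
  open import Algebra.Properties.Ring ring using (-‿+-comm; -0#≈0#; -‿involutive; -‿distribˡ-*; -‿distribʳ-*)
  open import Algebra.Properties.Semiring.Mult semiring using (×-homo-+; ×1-homo-*) renaming (_×_ to _×ᴿ_)

  nat : ℕ → Carrier
  nat n = n ×ᴿ 1#

  nat-+ : ∀ m n → nat (m ℕ.+ n) ≈ nat m + nat n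
  nat-+ = ×-homo-+ 1#

  nat-* : ∀ m n → nat (m ℕ.* n) ≈ nat m * nat n
  nat-* = ×1-homo-*

  int : ℤ → Carrier
  int (+ n) = nat n
  int -[1+ n ] = - nat (suc n)

  int-⊖ : ∀ m n → int (m ⊖ n) ≈ nat m - nat n
  int-⊖ zero zero = sym (trans (+-congˡ -0#≈0#) (+-identityʳ _))
  int-⊖ zero (suc n) = sym (+-identityˡ _)
  int-⊖ (suc m) zero = sym (trans (+-congˡ -0#≈0#) (+-identityʳ _))
  int-⊖ (suc m) (suc n) = begin
    int (suc m ⊖ suc n)           ≡⟨ ≡.cong int (ℤP.[1+m]⊖[1+n]≡m⊖n m n) ⟩
    int (m ⊖ n)                   ≈⟨ int-⊖ m n ⟩
    nat m - nat n                 ≈⟨ sym (+-identityˡ _) ⟩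
    0# + (nat m - nat n)          ≈⟨ +-congʳ (sym (-‿inverseʳ 1#)) ⟩
    (1# - 1#) + (nat m - nat n)   ≈⟨ interchange ⟩
    (1# + nat m) + (- 1# - nat n) ≈⟨ +-congˡ (-‿+-comm 1# (nat n)) ⟩
    (1# + nat m) - (1# + nat n)   ∎
    where
    interchange : (1# - 1#) + (nat m - nat n) ≈ (1# + nat m) + (- 1# - nat n)
    interchange = trans (+-assoc _ _ _) (trans (+-congˡ (trans (sym (+-assoc _ _ _))
      (trans (+-congʳ (+-comm _ _)) (+-assoc _ _ _)))) (sym (+-assoc _ _ _)))

  int-+ : ∀ i j → int (i ℤ.+ j) ≈ int i + int j
  int-+ -[1+ m ] -[1+ n ] = begin
    - nat (suc (suc (m ℕ.+ n)))   ≡⟨ ≡.cong (λ k → - nat (suc k)) (≡.sym (ℕP.+-suc m n)) ⟩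
    - nat (suc m ℕ.+ suc n)       ≈⟨ -‿cong (nat-+ (suc m) (suc n)) ⟩
    - (nat (suc m) + nat (suc n)) ≈⟨ sym (-‿+-comm _ _) ⟩
    - nat (suc m) + - nat (suc n) ∎
  int-+ -[1+ m ] (+ n) = trans (int-⊖ n (suc m)) (+-comm _ _)
  int-+ (+ m) -[1+ n ] = int-⊖ m (suc n)
  int-+ (+ m) (+ n) = nat-+ m n

  private
    int-◃+ : ∀ n → int (Sign.+ ℤ.◃ n) ≈ nat n
    int-◃+ zero = refl
    int-◃+ (suc n) = refl

    int-◃- : ∀ n → int (Sign.- ℤ.◃ n) ≈ - nat n
    int-◃- zero = sym -0#≈0#
    int-◃- (suc n) = refl

  int-* : ∀ i j → int (i ℤ.* j) ≈ int i * int j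
  int-* (+ m) (+ n) = trans (int-◃+ (m ℕ.* n)) (nat-* m n)
  int-* (+ m) -[1+ n ] = trans (int-◃- (m ℕ.* suc n)) (trans (-‿cong (nat-* m (suc n))) (-‿distribʳ-* _ _))
  int-* -[1+ m ] (+ n) = trans (int-◃- (suc m ℕ.* n)) (trans (-‿cong (nat-* (suc m) n)) (-‿distribˡ-* _ _))
  int-* -[1+ m ] -[1+ n ] = trans (int-◃+ (suc m ℕ.* suc n)) (trans (nat-* (suc m) (suc n))
    (trans (sym (-‿involutive _)) (trans (-‿cong (-‿distribˡ-* _ _)) (-‿distribʳ-* _ _))))

  int-neg : ∀ i → int (ℤ.- i) ≈ - int i
  int-neg (+ zero) = sym -0#≈0#
  int-neg (+ suc n) = refl
  int-neg -[1+ n ] = sym (-‿involutive _)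

  -- int is a ring morphism, so the library solver applies to R with
  -- coefficients in ℤ (only syntactic equality of coefficients is used).
  private
    int-morphism : ℤ.+-*-rawRing ACR.-Raw-AlmostCommutative⟶ ACR.fromCommutativeRing R
    int-morphism = record
      { ⟦_⟧ = int ; +-homo = int-+ ; *-homo = int-* ; -‿homo = int-neg
      ; 0-homo = refl ; 1-homo = +-identityʳ _ }

    int-equal? : ∀ i j → Maybe (int i ≈ int j)
    int-equal? i j with i ℤ.≟ j
    ... | yes ≡.refl = just refl
    ... | no _ = nothing

  open import Algebra.Solver.Ring ℤ.+-*-rawRing (ACR.fromCommutativeRing R) int-morphism int-equal? public
    using (solve; _:+_; _:*_; :-_; _:-_; _:=_; con)

module FiniteSums {c ℓ} (R : CommutativeRing c ℓ) where
  open import Data.Nat as ℕ using (zero; suc)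
  import Data.Nat.Properties as ℕP
  open import Data.List using (map; foldr; applyUpTo)
  open import Function using (_∘_)
  open import Relation.Binary.PropositionalEquality as ≡ using (_≡_; _≢_)
  open import Relation.Binary.Definitions using (tri<; tri≈; tri>)
  open import Data.Empty using (⊥-elim)
  open CommutativeRing R
  open import Relation.Binary.Reasoning.Setoid setoid
  open import Algebra.Properties.Ring ring using (-0#≈0#; -‿+-comm)

  Σ' : ℕ → (ℕ → Carrier) → Carrier
  Σ' zero g = 0#
  Σ' (suc n) g = Σ' n g + g n

  Σ-cong : ∀ n {g h : ℕ → Carrier} → (∀ j → j < n → g j ≈ h j) → Σ' n g ≈ Σ' n h
  Σ-cong zero e = refl
  Σ-cong (suc n) e = +-cong (Σ-cong n (λ j j<n → e j (ℕP.m<n⇒m<1+n j<n))) (e n ℕP.≤-refl)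

  Σ-cong' : ∀ n {g h : ℕ → Carrier} → (∀ j → g j ≈ h j) → Σ' n g ≈ Σ' n h
  Σ-cong' n e = Σ-cong n (λ j _ → e j)

  Σ-zero : ∀ n {g : ℕ → Carrier} → (∀ j → j < n → g j ≈ 0#) → Σ' n g ≈ 0#
  Σ-zero zero e = refl
  Σ-zero (suc n) e = trans (+-cong (Σ-zero n (λ j j<n → e j (ℕP.m<n⇒m<1+n j<n))) (e n ℕP.≤-refl)) (+-identityʳ 0#)

  Σ-+ : ∀ n (g h : ℕ → Carrier) → Σ' n (λ j → g j + h j) ≈ Σ' n g + Σ' n h
  Σ-+ zero g h = sym (+-identityʳ 0#)
  Σ-+ (suc n) g h = begin
    Σ' n (λ j → g j + h j) + (g n + h n) ≈⟨ +-congʳ (Σ-+ n g h) ⟩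
    (Σ' n g + Σ' n h) + (g n + h n)      ≈⟨ +-assoc _ _ _ ⟩
    Σ' n g + (Σ' n h + (g n + h n))      ≈⟨ +-congˡ (sym (+-assoc _ _ _)) ⟩
    Σ' n g + ((Σ' n h + g n) + h n)      ≈⟨ +-congˡ (+-congʳ (+-comm _ _)) ⟩
    Σ' n g + ((g n + Σ' n h) + h n)      ≈⟨ +-congˡ (+-assoc _ _ _) ⟩
    Σ' n g + (g n + (Σ' n h + h n))      ≈⟨ sym (+-assoc _ _ _) ⟩
    (Σ' n g + g n) + (Σ' n h + h n)      ∎

  Σ-*ˡ : ∀ n a (g : ℕ → Carrier) → a * Σ' n g ≈ Σ' n (λ j → a * g j)
  Σ-*ˡ zero a g = zeroʳ a
  Σ-*ˡ (suc n) a g = trans (distribˡ _ _ _) (+-congʳ (Σ-*ˡ n a g))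

  Σ-*ʳ : ∀ n a (g : ℕ → Carrier) → Σ' n g * a ≈ Σ' n (λ j → g j * a)
  Σ-*ʳ n a g = trans (*-comm _ _) (trans (Σ-*ˡ n a g) (Σ-cong' n (λ j → *-comm _ _)))

  Σ-neg : ∀ n (g : ℕ → Carrier) → - Σ' n g ≈ Σ' n (λ j → - g j)
  Σ-neg zero g = -0#≈0#
  Σ-neg (suc n) g = trans (sym (-‿+-comm _ _)) (+-congʳ (Σ-neg n g))

  Σ-shift : ∀ n (g : ℕ → Carrier) → Σ' (suc n) g ≈ g 0 + Σ' n (g ∘ suc)
  Σ-shift zero g = trans (+-identityˡ _) (sym (+-identityʳ _))
  Σ-shift (suc n) g = trans (+-congʳ (Σ-shift n g)) (+-assoc _ _ _)

  Σ-swap : ∀ n m (g : ℕ → ℕ → Carrier) → Σ' n (λ i → Σ' m (λ j → g i j)) ≈ Σ' m (λ j → Σ' n (λ i → g i j))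
  Σ-swap zero m g = sym (Σ-zero m (λ _ _ → refl))
  Σ-swap (suc n) m g = trans (+-congʳ (Σ-swap n m g)) (sym (Σ-+ m (λ j → Σ' n (λ i → g i j)) (λ j → g n j)))

  Σ-split : ∀ a b (g : ℕ → Carrier) → Σ' (a ℕ.+ b) g ≈ Σ' a g + Σ' b (λ j → g (a ℕ.+ j))
  Σ-split a zero g = trans (reflexive (≡.cong (λ k → Σ' k g) (ℕP.+-identityʳ a))) (sym (+-identityʳ _))
  Σ-split a (suc b) g = begin
    Σ' (a ℕ.+ suc b) g                                 ≡⟨ ≡.cong (λ k → Σ' k g) (ℕP.+-suc a b) ⟩
    Σ' (a ℕ.+ b) g + g (a ℕ.+ b)                       ≈⟨ +-congʳ (Σ-split a b g) ⟩
    (Σ' a g + Σ' b (λ j → g (a ℕ.+ j))) + g (a ℕ.+ b) ≈⟨ +-assoc _ _ _ ⟩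
    Σ' a g + Σ' (suc b) (λ j → g (a ℕ.+ j))            ∎

  foldr-map-applyUpTo : ∀ n (g : ℕ → Carrier) (h : ℕ → ℕ) → foldr _+_ 0# (map g (applyUpTo h n)) ≈ Σ' n (g ∘ h)
  foldr-map-applyUpTo zero g h = refl
  foldr-map-applyUpTo (suc n) g h = trans (+-congˡ (foldr-map-applyUpTo n g (h ∘ suc))) (sym (Σ-shift n (g ∘ h)))

  Σ-delta : ∀ n (g : ℕ → Carrier) k → k < n → (∀ j → j < n → j ≢ k → g j ≈ 0#) → Σ' n g ≈ g k
  Σ-delta zero g k () e
  Σ-delta (suc n) g k k<sn e with ℕP.<-cmp k n
  ... | tri< k<n _ _ = trans (+-cong (Σ-delta n g k k<n (λ j j<n → e j (ℕP.m<n⇒m<1+n j<n)))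
                                     (e n ℕP.≤-refl (λ n≡k → ℕP.<-irrefl (≡.sym n≡k) k<n))) (+-identityʳ _)
  ... | tri≈ _ ≡.refl _ = trans (+-congʳ (Σ-zero n (λ j j<n → e j (ℕP.m<n⇒m<1+n j<n) (λ j≡k → ℕP.<-irrefl j≡k j<n))))
                                (+-identityˡ _)
  ... | tri> _ _ k>n = ⊥-elim (ℕP.<-irrefl ≡.refl (ℕP.<-≤-trans k>n (ℕP.≤-pred k<sn)))

module PolynomialRing {c ℓ} (K : CommutativeRing c ℓ) where
  open import Data.Nat using (zero; suc)
  open import Data.List using ([]; _∷_; map)
  open import Data.Product using (_,_)
  open CommutativeRing K
  open Poly K
  open IntegerSolver K using (solve; _:+_; _:=_)
  open import Relation.Binary.Reasoning.Setoid setoid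
  open import Algebra.Properties.Ring ring using (-0#≈0#)

  coeff-+ : ∀ p q s → coeff (p +ₚ q) s ≈ coeff p s + coeff q s
  coeff-+ [] q s = sym (+-identityˡ _)
  coeff-+ (a ∷ p) [] s = sym (+-identityʳ _)
  coeff-+ (a ∷ p) (b ∷ q) zero = refl
  coeff-+ (a ∷ p) (b ∷ q) (suc s) = coeff-+ p q s

  coeff-map : ∀ (g : Carrier → Carrier) → g 0# ≈ 0# → ∀ p s → coeff (map g p) s ≈ g (coeff p s)
  coeff-map g g0 [] s = sym g0
  coeff-map g g0 (a ∷ p) zero = refl
  coeff-map g g0 (a ∷ p) (suc s) = coeff-map g g0 p s

  coeff-neg : ∀ p s → coeff (-ₚ p) s ≈ - coeff p s
  coeff-neg = coeff-map -_ -0#≈0#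

  coeff-sc : ∀ a p s → coeff (map (a *_) p) s ≈ a * coeff p s
  coeff-sc a = coeff-map (a *_) (zeroʳ a)

  coeff-- : ∀ p q s → coeff (p -ₚ q) s ≈ coeff p s - coeff q s
  coeff-- p q s = trans (coeff-+ p (-ₚ q) s) (+-congˡ (coeff-neg q s))

  X : Pol → Pol
  X p = 0# ∷ p

  coeff-* : ∀ a p q s → coeff ((a ∷ p) *ₚ q) s ≈ a * coeff q s + coeff (X (p *ₚ q)) s
  coeff-* a p q s = trans (coeff-+ (map (a *_) q) (X (p *ₚ q)) s) (+-congʳ (coeff-sc a q s))

  -- coefficientwise equality packed in a record, so that Agda can infer
  -- the polynomials from a proof (_≈ₚ_ itself is not injective)
  infix 4 _≋_
  record _≋_ (p q : Pol) : Set ℓ where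
    constructor mk
    field get : p ≈ₚ q
  open _≋_ public

  ≋-refl : ∀ {p} → p ≋ p
  ≋-refl = mk λ s → refl
  ≋-sym : ∀ {p q} → p ≋ q → q ≋ p
  ≋-sym (mk e) = mk λ s → sym (e s)
  ≋-trans : ∀ {p q r} → p ≋ q → q ≋ r → p ≋ r
  ≋-trans (mk e) (mk f) = mk λ s → trans (e s) (f s)

  X-cong : ∀ {p q} → p ≋ q → X p ≋ X q
  X-cong (mk e) = mk λ { zero → refl ; (suc s) → e s }

  +-congₚ : ∀ {p p' q q'} → p ≋ p' → q ≋ q' → (p +ₚ q) ≋ (p' +ₚ q')
  +-congₚ {p} {p'} {q} {q'} (mk e) (mk f) = mk λ s → trans (coeff-+ p q s) (trans (+-cong (e s) (f s)) (sym (coeff-+ p' q' s)))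

  neg-congₚ : ∀ {p p'} → p ≋ p' → (-ₚ p) ≋ (-ₚ p')
  neg-congₚ {p} {p'} (mk e) = mk λ s → trans (coeff-neg p s) (trans (-‿cong (e s)) (sym (coeff-neg p' s)))

  sc-congₚ : ∀ {a a'} {p p'} → a ≈ a' → p ≋ p' → map (a *_) p ≋ map (a' *_) p'
  sc-congₚ {a} {a'} {p} {p'} e (mk f) = mk λ s → trans (coeff-sc a p s) (trans (*-cong e (f s)) (sym (coeff-sc a' p' s)))

  zero-* : ∀ p q → (∀ s → coeff p s ≈ 0#) → (p *ₚ q) ≋ []
  zero-* [] q z = mk λ s → refl
  zero-* (a ∷ p) q z = mk λ s → trans (coeff-* a p q s) (trans (+-cong (trans (*-congʳ (z 0)) (zeroˡ _)) (lem s)) (+-identityʳ 0#))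
    where
    lem : ∀ s → coeff (X (p *ₚ q)) s ≈ 0#
    lem zero = refl
    lem (suc s) = get (zero-* p q (λ t → z (suc t))) s

  *-congʳₚ : ∀ p {q q'} → q ≋ q' → (p *ₚ q) ≋ (p *ₚ q')
  *-congʳₚ [] e = ≋-refl
  *-congʳₚ (a ∷ p) e = +-congₚ (sc-congₚ refl e) (X-cong (*-congʳₚ p e))

  *-congˡₚ : ∀ {p p'} q → p ≋ p' → (p *ₚ q) ≋ (p' *ₚ q)
  *-congˡₚ {[]} {[]} q e = ≋-refl
  *-congˡₚ {[]} {b ∷ p'} q (mk e) = ≋-sym (zero-* (b ∷ p') q (λ s → sym (e s)))
  *-congˡₚ {a ∷ p} {[]} q (mk e) = zero-* (a ∷ p) q e
  *-congˡₚ {a ∷ p} {b ∷ p'} q (mk e) = +-congₚ {map (a *_) q} {map (b *_) q} (sc-congₚ {p = q} {p' = q} (e 0) ≋-refl) (X-cong (*-congˡₚ {p} {p'} q (mk λ s → e (suc s))))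

  *-congₚ : ∀ {p p' q q'} → p ≋ p' → q ≋ q' → (p *ₚ q) ≋ (p' *ₚ q')
  *-congₚ {p} {p'} {q} {q'} e f = ≋-trans (*-congˡₚ q e) (*-congʳₚ p' f)

  +-assocₚ : ∀ p q r → ((p +ₚ q) +ₚ r) ≋ (p +ₚ (q +ₚ r))
  +-assocₚ p q r = mk λ s → begin
    coeff ((p +ₚ q) +ₚ r) s ≈⟨ coeff-+ (p +ₚ q) r s ⟩
    coeff (p +ₚ q) s + coeff r s ≈⟨ +-congʳ (coeff-+ p q s) ⟩
    coeff p s + coeff q s + coeff r s ≈⟨ +-assoc _ _ _ ⟩
    coeff p s + (coeff q s + coeff r s) ≈⟨ +-congˡ (sym (coeff-+ q r s)) ⟩
    coeff p s + coeff (q +ₚ r) s ≈⟨ sym (coeff-+ p (q +ₚ r) s) ⟩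
    coeff (p +ₚ (q +ₚ r)) s ∎

  +-commₚ : ∀ p q → (p +ₚ q) ≋ (q +ₚ p)
  +-commₚ p q = mk λ s → trans (coeff-+ p q s) (trans (+-comm _ _) (sym (coeff-+ q p s)))

  +-identityˡₚ : ∀ p → ([] +ₚ p) ≋ p
  +-identityˡₚ p = ≋-refl

  +-identityʳₚ : ∀ p → (p +ₚ []) ≋ p
  +-identityʳₚ p = mk λ s → trans (coeff-+ p [] s) (+-identityʳ _)

  -‿inverseˡₚ : ∀ p → ((-ₚ p) +ₚ p) ≋ []
  -‿inverseˡₚ p = mk λ s → trans (coeff-+ (-ₚ p) p s) (trans (+-congʳ (coeff-neg p s)) (-‿inverseˡ _))

  -‿inverseʳₚ : ∀ p → (p +ₚ (-ₚ p)) ≋ []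
  -‿inverseʳₚ p = mk λ s → trans (coeff-+ p (-ₚ p) s) (trans (+-congˡ (coeff-neg p s)) (-‿inverseʳ _))

  *-zeroʳₚ : ∀ p → (p *ₚ []) ≋ []
  *-zeroʳₚ [] = ≋-refl
  *-zeroʳₚ (a ∷ p) = mk λ { zero → refl ; (suc s) → get (*-zeroʳₚ p) s }

  X-+ : ∀ p q → X (p +ₚ q) ≋ (X p +ₚ X q)
  X-+ p q = mk λ { zero → sym (+-identityʳ 0#) ; (suc s) → refl }

  sc-+ : ∀ a p q → map (a *_) (p +ₚ q) ≋ (map (a *_) p +ₚ map (a *_) q)
  sc-+ a p q = mk λ s → begin
    coeff (map (a *_) (p +ₚ q)) s ≈⟨ coeff-sc a (p +ₚ q) s ⟩
    a * coeff (p +ₚ q) s ≈⟨ *-congˡ (coeff-+ p q s) ⟩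
    a * (coeff p s + coeff q s) ≈⟨ distribˡ _ _ _ ⟩
    a * coeff p s + a * coeff q s ≈⟨ sym (+-cong (coeff-sc a p s) (coeff-sc a q s)) ⟩
    coeff (map (a *_) p) s + coeff (map (a *_) q) s ≈⟨ sym (coeff-+ (map (a *_) p) (map (a *_) q) s) ⟩
    coeff (map (a *_) p +ₚ map (a *_) q) s ∎

  +-interchangeₚ : ∀ p q r t → ((p +ₚ q) +ₚ (r +ₚ t)) ≋ ((p +ₚ r) +ₚ (q +ₚ t))
  +-interchangeₚ p q r t = mk λ s → begin
    coeff ((p +ₚ q) +ₚ (r +ₚ t)) s ≈⟨ trans (coeff-+ (p +ₚ q) (r +ₚ t) s) (+-cong (coeff-+ p q s) (coeff-+ r t s)) ⟩
    (coeff p s + coeff q s) + (coeff r s + coeff t s) ≈⟨ solve 4 (λ a b c d → (a :+ b) :+ (c :+ d) := (a :+ c) :+ (b :+ d)) refl _ _ _ _ ⟩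
    (coeff p s + coeff r s) + (coeff q s + coeff t s) ≈⟨ sym (trans (coeff-+ (p +ₚ r) (q +ₚ t) s) (+-cong (coeff-+ p r s) (coeff-+ q t s))) ⟩
    coeff ((p +ₚ r) +ₚ (q +ₚ t)) s ∎

  *-distribˡₚ : ∀ p q r → (p *ₚ (q +ₚ r)) ≋ ((p *ₚ q) +ₚ (p *ₚ r))
  *-distribˡₚ [] q r = ≋-refl
  *-distribˡₚ (a ∷ p) q r = ≋-trans (+-congₚ (sc-+ a q r) (≋-trans (X-cong (*-distribˡₚ p q r)) (X-+ (p *ₚ q) (p *ₚ r))))
                               (+-interchangeₚ (map (a *_) q) (map (a *_) r) (X (p *ₚ q)) (X (p *ₚ r)))

  *-consʳ : ∀ q a p → (q *ₚ (a ∷ p)) ≋ (map (a *_) q +ₚ X (q *ₚ p))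
  *-consʳ [] a p = mk λ { zero → refl ; (suc s) → refl }
  *-consʳ (b ∷ q) a p = mk λ { zero → +-congʳ (*-comm b a) ; (suc s) → begin
    coeff (map (b *_) p +ₚ (q *ₚ (a ∷ p))) s ≈⟨ coeff-+ (map (b *_) p) (q *ₚ (a ∷ p)) s ⟩
    coeff (map (b *_) p) s + coeff (q *ₚ (a ∷ p)) s ≈⟨ +-congˡ (get (*-consʳ q a p) s) ⟩
    coeff (map (b *_) p) s + coeff (map (a *_) q +ₚ X (q *ₚ p)) s ≈⟨ +-congˡ (coeff-+ (map (a *_) q) (X (q *ₚ p)) s) ⟩
    coeff (map (b *_) p) s + (coeff (map (a *_) q) s + coeff (X (q *ₚ p)) s) ≈⟨ solve 3 (λ u v w → u :+ (v :+ w) := v :+ (u :+ w)) refl _ _ _ ⟩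
    coeff (map (a *_) q) s + (coeff (map (b *_) p) s + coeff (X (q *ₚ p)) s) ≈⟨ +-congˡ (sym (coeff-+ (map (b *_) p) (X (q *ₚ p)) s)) ⟩
    coeff (map (a *_) q) s + coeff (map (b *_) p +ₚ X (q *ₚ p)) s ≈⟨ sym (coeff-+ (map (a *_) q) (map (b *_) p +ₚ X (q *ₚ p)) s) ⟩
    coeff (map (a *_) q +ₚ (map (b *_) p +ₚ X (q *ₚ p))) s ∎ }

  *-commₚ : ∀ p q → (p *ₚ q) ≋ (q *ₚ p)
  *-commₚ [] q = ≋-sym (*-zeroʳₚ q)
  *-commₚ (a ∷ p) q = ≋-sym (≋-trans (*-consʳ q a p) (+-congₚ ≋-refl (X-cong (*-commₚ q p))))

  *-distribʳₚ : ∀ r p q → ((p +ₚ q) *ₚ r) ≋ ((p *ₚ r) +ₚ (q *ₚ r))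
  *-distribʳₚ r p q = ≋-trans (*-commₚ (p +ₚ q) r) (≋-trans (*-distribˡₚ r p q) (+-congₚ (*-commₚ r p) (*-commₚ r q)))

  sc-* : ∀ a p q → ((map (a *_) p) *ₚ q) ≋ map (a *_) (p *ₚ q)
  sc-* a [] q = ≋-refl
  sc-* a (b ∷ p) q = mk λ s → begin
    coeff (map ((a * b) *_) q +ₚ X (map (a *_) p *ₚ q)) s ≈⟨ coeff-+ (map ((a * b) *_) q) (X (map (a *_) p *ₚ q)) s ⟩
    coeff (map ((a * b) *_) q) s + coeff (X (map (a *_) p *ₚ q)) s ≈⟨ +-cong (coeff-sc _ q s) (get (X-cong (sc-* a p q)) s) ⟩
    (a * b) * coeff q s + coeff (X (map (a *_) (p *ₚ q))) s ≈⟨ +-cong (*-assoc _ _ _) (lem s) ⟩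
    a * (b * coeff q s) + a * coeff (X (p *ₚ q)) s ≈⟨ sym (distribˡ _ _ _) ⟩
    a * (b * coeff q s + coeff (X (p *ₚ q)) s) ≈⟨ *-congˡ (sym (coeff-* b p q s)) ⟩
    a * coeff ((b ∷ p) *ₚ q) s ≈⟨ sym (coeff-sc a ((b ∷ p) *ₚ q) s) ⟩
    coeff (map (a *_) ((b ∷ p) *ₚ q)) s ∎
    where
    lem : ∀ s → coeff (X (map (a *_) (p *ₚ q))) s ≈ a * coeff (X (p *ₚ q)) s
    lem zero = sym (zeroʳ a)
    lem (suc s) = coeff-sc a (p *ₚ q) s

  X-* : ∀ p q → (X p *ₚ q) ≋ X (p *ₚ q)
  X-* p q = mk λ s → trans (coeff-* 0# p q s) (trans (+-congʳ (zeroˡ _)) (+-identityˡ _))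

  *-assocₚ : ∀ p q r → ((p *ₚ q) *ₚ r) ≋ (p *ₚ (q *ₚ r))
  *-assocₚ [] q r = ≋-refl
  *-assocₚ (a ∷ p) q r = ≋-trans (*-distribʳₚ r (map (a *_) q) (X (p *ₚ q)))
     (+-congₚ (sc-* a q r) (≋-trans (X-* (p *ₚ q) r) (X-cong (*-assocₚ p q r))))

  *-identityˡₚ : ∀ p → (oneₚ *ₚ p) ≋ p
  *-identityˡₚ p = mk λ s → trans (coeff-* 1# [] p s) (trans (+-cong (*-identityˡ _) (lem s)) (+-identityʳ _))
    where
    lem : ∀ s → coeff (X ([] *ₚ p)) s ≈ 0#
    lem zero = refl
    lem (suc s) = refl

  *-identityʳₚ : ∀ p → (p *ₚ oneₚ) ≋ p
  *-identityʳₚ p = ≋-trans (*-commₚ p oneₚ) (*-identityˡₚ p)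

  PolRing : CommutativeRing c ℓ
  PolRing = record
    { Carrier = Pol ; _≈_ = _≋_ ; _+_ = _+ₚ_ ; _*_ = _*ₚ_ ; -_ = -ₚ_ ; 0# = [] ; 1# = oneₚ
    ; isCommutativeRing = record
      { isRing = record
        { +-isAbelianGroup = record
          { isGroup = record
            { isMonoid = record
              { isSemigroup = record
                { isMagma = record
                  { isEquivalence = record { refl = ≋-refl ; sym = ≋-sym ; trans = ≋-trans }
                  ; ∙-cong = +-congₚ }
                ; assoc = +-assocₚ }
              ; identity = +-identityˡₚ , +-identityʳₚ }
            ; inverse = -‿inverseˡₚ , -‿inverseʳₚ
            ; ⁻¹-cong = neg-congₚ }
          ; comm = +-commₚ }
        ; *-cong = *-congₚ
        ; *-assoc = *-assocₚ
        ; *-identity = *-identityˡₚ , *-identityʳₚ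
        ; distrib = (λ p q r → *-distribˡₚ p q r) , (λ r p q → *-distribʳₚ r p q) }
      ; *-comm = *-commₚ }
    }

module PolynomialDivisibility {c ℓ} (K : CommutativeRing c ℓ) where
  open import Level using (_⊔_)
  open import Data.List using ([])
  open CommutativeRing K
  open Poly K
  open PolynomialRing K
  private module PS = IntegerSolver PolRing

  infix 4 _∣'_
  record _∣'_ (M p : Pol) : Set (c ⊔ ℓ) where
    constructor _,_
    field
      quo : Pol
      quo-eq : p ≋ (quo *ₚ M)

  ∣'-zero : ∀ M → M ∣' []
  ∣'-zero M = [] , ≋-refl

  ∣'-cong : ∀ {M p p'} → p ≋ p' → M ∣' p → M ∣' p'
  ∣'-cong e (q , d) = q , ≋-trans (≋-sym e) d

  ∣'-congˡ : ∀ {M M' p} → M ≋ M' → M ∣' p → M' ∣' p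
  ∣'-congˡ {M} {M'} e (q , d) = q , ≋-trans d (*-congʳₚ q e)

  ∣'-+ : ∀ {M p q} → M ∣' p → M ∣' q → M ∣' (p +ₚ q)
  ∣'-+ {M} (u , d) (v , e) = (u +ₚ v) , ≋-trans (+-congₚ d e) (≋-sym (*-distribʳₚ M u v))

  ∣'-neg : ∀ {M p} → M ∣' p → M ∣' (-ₚ p)
  ∣'-neg {M} {p} (u , d) = (-ₚ u) , ≋-trans (neg-congₚ d) (PS.solve 2 (λ u M → PS.:- (u PS.:* M) PS.:= (PS.:- u) PS.:* M) ≋-refl u M)

  ∣'-* : ∀ {M p} r → M ∣' p → M ∣' (r *ₚ p)
  ∣'-* {M} {p} r (u , d) = (r *ₚ u) , ≋-trans (*-congʳₚ r d) (≋-sym (*-assocₚ r u M))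

  ∣'-trans : ∀ {A B p} → A ∣' B → B ∣' p → A ∣' p
  ∣'-trans {A} {B} {p} (u , d) (v , e) = (v *ₚ u) , ≋-trans e (≋-trans (*-congʳₚ v d) (≋-sym (*-assocₚ v u A)))

  ∣'-mulʳ : ∀ {M} q → M ∣' (M *ₚ q)
  ∣'-mulʳ {M} q = q , *-commₚ M q

  infix 4 _≡_[mod_]
  record _≡_[mod_] (a b M : Pol) : Set (c ⊔ ℓ) where
    constructor cg
    field getcg : M ∣' (a -ₚ b)
  open _≡_[mod_] public

  ≋⇒≡ : ∀ {a b M} → a ≋ b → a ≡ b [mod M ]
  ≋⇒≡ {a} {b} e = cg (∣'-cong (≋-sym (≋-trans (+-congₚ e ≋-refl) (-‿inverseʳₚ b))) (∣'-zero _))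

  ≡-refl : ∀ {a M} → a ≡ a [mod M ]
  ≡-refl = ≋⇒≡ ≋-refl

  ≡-sym : ∀ {a b M} → a ≡ b [mod M ] → b ≡ a [mod M ]
  ≡-sym {a} {b} (cg d) = cg (∣'-cong (PS.solve 2 (λ a b → PS.:- (a PS.:- b) PS.:= b PS.:- a) ≋-refl a b) (∣'-neg d))

  ≡-trans : ∀ {a b c M} → a ≡ b [mod M ] → b ≡ c [mod M ] → a ≡ c [mod M ]
  ≡-trans {a} {b} {c} (cg d) (cg e) = cg (∣'-cong (PS.solve 3 (λ a b c → (a PS.:- b) PS.:+ (b PS.:- c) PS.:= a PS.:- c) ≋-refl a b c) (∣'-+ d e))

  ≡-+ : ∀ {a b a' b' M} → a ≡ b [mod M ] → a' ≡ b' [mod M ] → (a +ₚ a') ≡ (b +ₚ b') [mod M ]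
  ≡-+ {a} {b} {a'} {b'} (cg d) (cg e) = cg (∣'-cong (PS.solve 4 (λ a b a' b' → (a PS.:- b) PS.:+ (a' PS.:- b') PS.:= (a PS.:+ a') PS.:- (b PS.:+ b')) ≋-refl a b a' b') (∣'-+ d e))

  ≡-*ˡ : ∀ {a b M} r → a ≡ b [mod M ] → (r *ₚ a) ≡ (r *ₚ b) [mod M ]
  ≡-*ˡ {a} {b} r (cg d) = cg (∣'-cong (PS.solve 3 (λ r a b → r PS.:* (a PS.:- b) PS.:= r PS.:* a PS.:- r PS.:* b) ≋-refl r a b) (∣'-* r d))

  ≡-*ʳ : ∀ {a b M} r → a ≡ b [mod M ] → (a *ₚ r) ≡ (b *ₚ r) [mod M ]
  ≡-*ʳ {a} {b} r (cg d) = cg (∣'-cong (PS.solve 3 (λ r a b → r PS.:* (a PS.:- b) PS.:= a PS.:* r PS.:- b PS.:* r) ≋-refl r a b) (∣'-* r d))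

  ≡-* : ∀ {a b a' b' M} → a ≡ b [mod M ] → a' ≡ b' [mod M ] → (a *ₚ a') ≡ (b *ₚ b') [mod M ]
  ≡-* {a} {b} {a'} {b'} d e = ≡-trans (≡-*ʳ a' d) (≡-*ˡ b e)

  ≡-weaken : ∀ {a b M M'} → M' ∣' M → a ≡ b [mod M ] → a ≡ b [mod M' ]
  ≡-weaken d (cg e) = cg (∣'-trans d e)

  ≡-≋ˡ : ∀ {a a' b M} → a ≋ a' → a ≡ b [mod M ] → a' ≡ b [mod M ]
  ≡-≋ˡ e d = ≡-trans (≋⇒≡ (≋-sym e)) d

  ≡-≋ʳ : ∀ {a b b' M} → b ≋ b' → a ≡ b [mod M ] → a ≡ b' [mod M ]
  ≡-≋ʳ e d = ≡-trans d (≋⇒≡ e)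

  ≡0⇒∣ : ∀ {a M} → a ≡ [] [mod M ] → M ∣' a
  ≡0⇒∣ {a} (cg d) = ∣'-cong (+-identityʳₚ a) d

  ∣⇒≡0 : ∀ {a M} → M ∣' a → a ≡ [] [mod M ]
  ∣⇒≡0 {a} d = cg (∣'-cong (≋-sym (+-identityʳₚ a)) d)

module PolynomialFacts {c ℓ} (K : CommutativeRing c ℓ) where
  open import Data.Nat as ℕ using (zero; suc; s≤s)
  import Data.Nat.Properties as ℕP
  open import Data.Nat.Induction using (<-rec)
  open import Data.List using ([]; _∷_; map; length; applyUpTo; upTo)
  open import Relation.Binary.PropositionalEquality as ≡ using (_≡_; _≢_)
  open import Relation.Nullary using (yes; no)
  open import Data.Empty using (⊥-elim)
  open import Function using (_∘_)
  open CommutativeRing K hiding (zero)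
  open Poly K
  open PolynomialRing K
  open PolynomialDivisibility K
  open import Algebra.Properties.Ring ring using (-0#≈0#; -‿injective; -‿distribˡ-*; x∙y⁻¹≈ε⇒x≈y)
  open FiniteSums K public using ()
    renaming (Σ' to ΣK; Σ-cong' to ΣK-cong'; Σ-zero to ΣK-zero; Σ-*ʳ to ΣK-*ʳ; Σ-delta to ΣK-delta;
              foldr-map-applyUpTo to foldrK-map-applyUpTo)
  open FiniteSums PolRing public using ()
    renaming (Σ' to ΣP; Σ-cong' to ΣP-cong'; Σ-*ʳ to ΣP-*ʳ; Σ-delta to ΣP-delta)

  x-y≈0⇒x≈y : ∀ {x y} → x - y ≈ 0# → x ≈ y
  x-y≈0⇒x≈y {x} {y} = x∙y⁻¹≈ε⇒x≈y x y

  coeff-Σ : ∀ n (g : ℕ → Pol) s → coeff (ΣP n g) s ≈ ΣK n (λ j → coeff (g j) s)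
  coeff-Σ zero g s = refl
  coeff-Σ (suc n) g s = trans (coeff-+ (ΣP n g) (g n) s) (+-congʳ (coeff-Σ n g s))

  ΣP-mod : ∀ n (g h : ℕ → Pol) {M} → (∀ j → j < n → g j ≡ h j [mod M ]) → ΣP n g ≡ ΣP n h [mod M ]
  ΣP-mod zero g h e = ≡-refl
  ΣP-mod (suc n) g h e = ≡-+ (ΣP-mod n g h (λ j j<n → e j (ℕP.m<n⇒m<1+n j<n))) (e n ℕP.≤-refl)

  cst : Carrier → Pol
  cst a = a ∷ []

  cst-* : ∀ a p → (cst a *ₚ p) ≋ map (a *_) p
  cst-* a p = mk λ s → trans (coeff-* a [] p s) (trans (+-congˡ (no-tail s)) (trans (+-identityʳ _) (sym (coeff-sc a p s))))
    where
    no-tail : ∀ s → coeff (X ([] *ₚ p)) s ≈ 0#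
    no-tail zero = refl
    no-tail (suc s) = refl

  coeff-cst* : ∀ a p s → coeff (cst a *ₚ p) s ≈ a * coeff p s
  coeff-cst* a p s = trans (get (cst-* a p) s) (coeff-sc a p s)

  cst-cong : ∀ {a b} → a ≈ b → cst a ≋ cst b
  cst-cong e = mk λ { zero → e ; (suc s) → refl }

  cst-+ : ∀ a b → cst (a + b) ≋ (cst a +ₚ cst b)
  cst-+ a b = ≋-refl

  cst-mul : ∀ a b → cst (a * b) ≋ (cst a *ₚ cst b)
  cst-mul a b = ≋-sym (cst-* a (cst b))

  cst-0 : cst 0# ≋ []
  cst-0 = mk λ { zero → refl ; (suc s) → refl }

  ΣP-cst : ∀ m (g : ℕ → Carrier) → ΣP m (λ j → cst (g j)) ≋ cst (ΣK m g)
  ΣP-cst zero g = ≋-sym cst-0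
  ΣP-cst (suc m) g = ≋-trans (+-congₚ (ΣP-cst m g) (≋-refl {cst (g m)})) (≋-sym (cst-+ (ΣK m g) (g m)))

  X≋x* : ∀ p → X p ≋ (xPow 1 *ₚ p)
  X≋x* p = ≋-sym (≋-trans (X-* oneₚ p) (X-cong (*-identityˡₚ p)))

  xPow-+ : ∀ m n → xPow (m ℕ.+ n) ≋ (xPow m *ₚ xPow n)
  xPow-+ zero n = ≋-sym (*-identityˡₚ (xPow n))
  xPow-+ (suc m) n = ≋-trans (X-cong (xPow-+ m n)) (≋-sym (X-* (xPow m) (xPow n)))

  coeff-xPow*-lo : ∀ d q s → s < d → coeff (xPow d *ₚ q) s ≈ 0#
  coeff-xPow*-lo (suc d) q zero s<d = get (X-* (xPow d) q) zero
  coeff-xPow*-lo (suc d) q (suc s) (s≤s s<d) = trans (get (X-* (xPow d) q) (suc s)) (coeff-xPow*-lo d q s s<d)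

  coeff-xPow*-hi : ∀ d q t → coeff (xPow d *ₚ q) (d ℕ.+ t) ≈ coeff q t
  coeff-xPow*-hi zero q t = get (*-identityˡₚ q) t
  coeff-xPow*-hi (suc d) q t = trans (get (X-* (xPow d) q) (suc (d ℕ.+ t))) (coeff-xPow*-hi d q t)

  coeff-xPow-same : ∀ d → coeff (xPow d) d ≈ 1#
  coeff-xPow-same zero = refl
  coeff-xPow-same (suc d) = coeff-xPow-same d

  coeff-xPow-diff : ∀ d s → d ≢ s → coeff (xPow d) s ≈ 0#
  coeff-xPow-diff zero zero ne = ⊥-elim (ne ≡.refl)
  coeff-xPow-diff zero (suc s) ne = refl
  coeff-xPow-diff (suc d) zero ne = refl
  coeff-xPow-diff (suc d) (suc s) ne = coeff-xPow-diff d s (λ e → ne (≡.cong suc e))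

  xm1 : ℕ → Pol
  xm1 = xPowMinusOne

  xPow≡1 : ∀ d → xPow d ≡ oneₚ [mod xm1 d ]
  xPow≡1 d = cg (oneₚ , ≋-sym (*-identityˡₚ (xm1 d)))

  xm1-expand : ∀ a q → (q *ₚ xm1 a) ≋ ((xPow a *ₚ q) -ₚ q)
  xm1-expand a q = ≋-trans (*-distribˡₚ q (xPow a) (-ₚ oneₚ)) (+-congₚ (*-commₚ q (xPow a)) times-minus-one)
    where
    times-minus-one : (q *ₚ (-ₚ oneₚ)) ≋ (-ₚ q)
    times-minus-one = ≋-trans (*-commₚ q (-ₚ oneₚ)) (≋-trans (cst-* (- 1#) q) (mk λ s →
      trans (coeff-sc (- 1#) q s) (trans (sym (-‿distribˡ-* 1# _)) (trans (-‿cong (*-identityˡ _)) (sym (coeff-neg q s))))))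

  coeff-xm1-lo : ∀ a q s → s < a → coeff (q *ₚ xm1 a) s ≈ - coeff q s
  coeff-xm1-lo a q s s<a = trans (get (xm1-expand a q) s)
    (trans (coeff-- (xPow a *ₚ q) q s) (trans (+-congʳ (coeff-xPow*-lo a q s s<a)) (+-identityˡ _)))

  coeff-xm1-hi : ∀ a q t → coeff (q *ₚ xm1 a) (a ℕ.+ t) ≈ coeff q t - coeff q (a ℕ.+ t)
  coeff-xm1-hi a q t = trans (get (xm1-expand a q) (a ℕ.+ t))
    (trans (coeff-- (xPow a *ₚ q) q (a ℕ.+ t)) (+-congʳ (coeff-xPow*-hi a q t)))

  -- x^a - 1 (a ≥ 1) is not a zero divisor: by strong induction on s,
  -- the coefficient s of q is read off from that of q (x^a - 1)
  xm1-cancel : ∀ a q → 1 ≤ a → (∀ s → coeff (q *ₚ xm1 a) s ≈ 0#) → ∀ s → coeff q s ≈ 0#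
  xm1-cancel a q a≥1 z = <-rec _ step
    where
    step : ∀ s → (∀ {t} → t < s → coeff q t ≈ 0#) → coeff q s ≈ 0#
    step s ih with s ℕ.<? a
    ... | yes s<a = -‿injective (trans (sym (coeff-xm1-lo a q s s<a)) (trans (z s) (sym -0#≈0#)))
    ... | no s≮a = ≡.subst (λ u → coeff q u ≈ 0#) (ℕP.m+[n∸m]≡n a≤s)
                     (trans (sym (x-y≈0⇒x≈y (trans (sym (coeff-xm1-hi a q (s ℕ.∸ a))) (z (a ℕ.+ (s ℕ.∸ a))))))
                            (ih (ℕP.∸-monoʳ-< {s} {a} {0} a≥1 a≤s)))
      where a≤s = ℕP.≮⇒≥ s≮a

  coeff-len : ∀ q s → length q ≤ s → coeff q s ≈ 0#
  coeff-len [] s _ = refl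
  coeff-len (a ∷ q) (suc s) (s≤s l) = coeff-len q s l

  -- a multiple of x^N - 1 of degree < N is zero: the cofactor q would
  -- have N-periodic coefficients, which eventually vanish
  deg-lemma : ∀ N h → 1 ≤ N → DegLt h N → xm1 N ∣' h → h ≋ []
  deg-lemma N h N≥1 deg (q , e) = ≋-trans e (zero-* q (xm1 N) q≈0)
    where
    periodic : ∀ t → coeff q t ≈ coeff q (N ℕ.+ t)
    periodic t = x-y≈0⇒x≈y (trans (sym (coeff-xm1-hi N q t)) (trans (sym (get e (N ℕ.+ t))) (deg (N ℕ.+ t) (ℕP.m≤m+n N t))))
    periodic* : ∀ k t → coeff q t ≈ coeff q (k ℕ.* N ℕ.+ t)
    periodic* zero t = refl
    periodic* (suc k) t = trans (periodic* k t)
      (trans (periodic (k ℕ.* N ℕ.+ t)) (reflexive (≡.cong (coeff q) (≡.sym (ℕP.+-assoc N (k ℕ.* N) t)))))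
    q≈0 : ∀ t → coeff q t ≈ 0#
    q≈0 t = trans (periodic* (length q) t) (coeff-len q _ (ℕP.≤-trans (ℕP.m≤m*n (length q) N) (ℕP.m≤m+n _ t)))
      where instance _ = ℕ.>-nonZero N≥1

  mkP : ℕ → (ℕ → Carrier) → Pol
  mkP n g = map g (upTo n)

  private
    coeff-map-applyUpTo-lt : ∀ (g : ℕ → Carrier) (h : ℕ → ℕ) n i → i < n → coeff (map g (applyUpTo h n)) i ≡ g (h i)
    coeff-map-applyUpTo-lt g h (suc n) zero _ = ≡.refl
    coeff-map-applyUpTo-lt g h (suc n) (suc i) (s≤s i<n) = coeff-map-applyUpTo-lt g (h ∘ suc) n i i<n

    coeff-map-applyUpTo-ge : ∀ (g : ℕ → Carrier) (h : ℕ → ℕ) n i → n ≤ i → coeff (map g (applyUpTo h n)) i ≡ 0#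
    coeff-map-applyUpTo-ge g h zero i _ = ≡.refl
    coeff-map-applyUpTo-ge g h (suc n) (suc i) (s≤s n≤i) = coeff-map-applyUpTo-ge g (h ∘ suc) n i n≤i

  coeff-mk-lt : ∀ n g i → i < n → coeff (mkP n g) i ≡ g i
  coeff-mk-lt n g i = coeff-map-applyUpTo-lt g (λ x → x) n i

  coeff-mk-ge : ∀ n g i → n ≤ i → coeff (mkP n g) i ≡ 0#
  coeff-mk-ge n g i = coeff-map-applyUpTo-ge g (λ x → x) n i

  mk-cong : ∀ n {g h : ℕ → Carrier} → (∀ i → i < n → g i ≈ h i) → mkP n g ≋ mkP n h
  mk-cong n {g} {h} e = mk λ i → case i
    where
    case : ∀ i → coeff (mkP n g) i ≈ coeff (mkP n h) i
    case i with i ℕ.<? n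
    ... | yes i<n = trans (reflexive (coeff-mk-lt n g i i<n)) (trans (e i i<n) (reflexive (≡.sym (coeff-mk-lt n h i i<n))))
    ... | no i≮n = trans (reflexive (coeff-mk-ge n g i (ℕP.≮⇒≥ i≮n))) (reflexive (≡.sym (coeff-mk-ge n h i (ℕP.≮⇒≥ i≮n))))

  mk-split : ∀ a b (g : ℕ → Carrier) → mkP (a ℕ.+ b) g ≋ (mkP a g +ₚ (xPow a *ₚ mkP b (λ i → g (a ℕ.+ i))))
  mk-split a b g = mk λ i → trans (split i) (sym (coeff-+ (mkP a g) (xPow a *ₚ mkP b g') i))
    where
    g' : ℕ → Carrier
    g' i = g (a ℕ.+ i)
    upper : ∀ t → coeff (mkP (a ℕ.+ b) g) (a ℕ.+ t) ≈ coeff (mkP b g') t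
    upper t with t ℕ.<? b
    ... | yes t<b = reflexive (≡.trans (coeff-mk-lt (a ℕ.+ b) g (a ℕ.+ t) (ℕP.+-monoʳ-< a t<b)) (≡.sym (coeff-mk-lt b g' t t<b)))
    ... | no t≮b = reflexive (≡.trans (coeff-mk-ge (a ℕ.+ b) g (a ℕ.+ t) (ℕP.+-monoʳ-≤ a (ℕP.≮⇒≥ t≮b)))
                                      (≡.sym (coeff-mk-ge b g' t (ℕP.≮⇒≥ t≮b))))
    split : ∀ i → coeff (mkP (a ℕ.+ b) g) i ≈ coeff (mkP a g) i + coeff (xPow a *ₚ mkP b g') i
    split i with i ℕ.<? a
    ... | yes i<a = trans (reflexive (≡.trans (coeff-mk-lt (a ℕ.+ b) g i (ℕP.≤-trans i<a (ℕP.m≤m+n a b))) (≡.sym (coeff-mk-lt a g i i<a))))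
                          (sym (trans (+-congˡ (coeff-xPow*-lo a _ i i<a)) (+-identityʳ _)))
    ... | no i≮a = ≡.subst (λ j → coeff (mkP (a ℕ.+ b) g) j ≈ coeff (mkP a g) j + coeff (xPow a *ₚ mkP b g') j)
                     (ℕP.m+[n∸m]≡n a≤i)
                     (trans (upper t) (sym (trans (+-cong (reflexive (coeff-mk-ge a g (a ℕ.+ t) (ℕP.m≤m+n a t)))
                                                          (coeff-xPow*-hi a _ t)) (+-identityˡ _))))
      where
      a≤i = ℕP.≮⇒≥ i≮a
      t = i ℕ.∸ a

module FilterOneTo where
  open import Data.Nat as ℕ using (zero; suc; z≤n; s≤s)
  import Data.Nat.Properties as ℕP
  open import Data.Bool using (Bool; true; false; _∧_; if_then_else_; T?)
  open import Data.List using ([]; _∷_; _++_; filterᵇ)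
  import Data.List.Properties as LP
  open import Data.List.Relation.Unary.All using (All)
  import Data.List.Relation.Unary.All.Properties as AP
  open import Relation.Binary.PropositionalEquality using (_≡_; refl; cong; sym; trans)
  open import Function using (_∘_)

  filterᵇ-oneTo-suc : ∀ (p : ℕ → Bool) n →
    filterᵇ p (oneTo (suc n)) ≡ filterᵇ p (oneTo n) ++ (if p (suc n) then suc n ∷ [] else [])
  filterᵇ-oneTo-suc p n = trans (cong (filterᵇ p) (sym (LP.applyUpTo-∷ʳ suc n)))
    (trans (LP.filter-++ (T? ∘ p) (oneTo n) (suc n ∷ [])) (cong (filterᵇ p (oneTo n) ++_) singleton))
    where
    singleton : filterᵇ p (suc n ∷ []) ≡ (if p (suc n) then suc n ∷ [] else [])
    singleton with p (suc n)
    ... | true = refl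
    ... | false = refl

  filterᵇ-oneTo-ext : ∀ (p q : ℕ → Bool) n → (∀ d → 1 ≤ d → d ≤ n → p d ≡ q d) → filterᵇ p (oneTo n) ≡ filterᵇ q (oneTo n)
  filterᵇ-oneTo-ext p q zero e = refl
  filterᵇ-oneTo-ext p q (suc n) e rewrite filterᵇ-oneTo-suc p n | filterᵇ-oneTo-suc q n
    | filterᵇ-oneTo-ext p q n (λ d d≥1 d≤n → e d d≥1 (ℕP.m≤n⇒m≤1+n d≤n)) | e (suc n) (s≤s z≤n) ℕP.≤-refl = refl

  filterᵇ-oneTo-extend : ∀ (p : ℕ → Bool) n k → (∀ d → n < d → d ≤ n ℕ.+ k → p d ≡ false) →
    filterᵇ p (oneTo (n ℕ.+ k)) ≡ filterᵇ p (oneTo n)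
  filterᵇ-oneTo-extend p n zero e rewrite ℕP.+-identityʳ n = refl
  filterᵇ-oneTo-extend p n (suc k) e rewrite ℕP.+-suc n k | filterᵇ-oneTo-suc p (n ℕ.+ k)
    | e (suc (n ℕ.+ k)) (s≤s (ℕP.m≤m+n n k)) ℕP.≤-refl
    | LP.++-identityʳ (filterᵇ p (oneTo (n ℕ.+ k)))
    = filterᵇ-oneTo-extend p n k (λ d n<d d≤ → e d n<d (ℕP.m≤n⇒m≤1+n d≤))

  filterᵇ-filterᵇ : ∀ (p q : ℕ → Bool) xs → filterᵇ p (filterᵇ q xs) ≡ filterᵇ (λ x → p x ∧ q x) xs
  filterᵇ-filterᵇ p q [] = refl
  filterᵇ-filterᵇ p q (x ∷ xs) with q x
  ... | true with p x
  ...   | true = cong (x ∷_) (filterᵇ-filterᵇ p q xs)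
  ...   | false = filterᵇ-filterᵇ p q xs
  filterᵇ-filterᵇ p q (x ∷ xs) | false with p x
  ...   | true = filterᵇ-filterᵇ p q xs
  ...   | false = filterᵇ-filterᵇ p q xs

  InRange : ℕ → ℕ → Set
  InRange n k = 1 ≤ k × k ≤ n

  all-filterᵇ-oneTo : ∀ (p : ℕ → Bool) n → All (InRange n) (filterᵇ p (oneTo n))
  all-filterᵇ-oneTo p n = AP.filter⁺ (T? ∘ p) (AP.applyUpTo⁺₁ suc n (λ i<n → s≤s z≤n , i<n))
    where open import Data.Product using (_,_)

module DecisionHelpers where
  open import Data.Bool using (true; not; T)
  open import Data.Unit using (tt)
  open import Data.Empty using (⊥-elim)
  open import Relation.Nullary using (¬_; yes; no; Dec; does)
  open import Relation.Binary.PropositionalEquality using (_≡_)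

  T-yes : ∀ {A : Set} (d : Dec A) → A → T (does d)
  T-yes (yes _) _ = tt
  T-yes (no ¬a) a = ⊥-elim (¬a a)

  T-no : ∀ {A : Set} (d : Dec A) → ¬ A → T (not (does d))
  T-no (yes a) ¬a = ⊥-elim (¬a a)
  T-no (no _) _ = tt

  witness : ∀ {A : Set} (d : Dec A) → does d ≡ true → A
  witness (yes a) _ = a
  witness (no _) ()

-- The geometric sums P_e(m) = Σ_{j<m} x^{je} = Σ_{i<me} [e ∣ i] x^i.
module GeometricSums {c ℓ} (K : CommutativeRing c ℓ) where
  open import Data.Nat as ℕ using (zero; suc)
  import Data.Nat.Properties as ℕP
  open import Data.Nat.Divisibility using (_∣?_; ∣⇒≤; ∣m+n∣m⇒∣n; ∣m∣n⇒∣m+n; ∣-refl; divides)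
  open import Data.Bool using (Bool; true; false)
  open import Relation.Binary.PropositionalEquality as ≡ using (_≡_)
  open import Relation.Nullary using (¬_; yes; no; does)
  open import Relation.Nullary.Decidable using (dec-true; dec-false)
  open import Data.Empty using (⊥-elim)
  open import Data.Integer using (+_)
  open CommutativeRing K hiding (zero)
  open Poly K
  open PolynomialRing K
  open PolynomialDivisibility K
  open PolynomialFacts K
  open IntegerSolver K using (nat)

  ind : Bool → Carrier
  ind true = 1#
  ind false = 0#

  divInd : ℕ → ℕ → Carrier
  divInd e i = ind (does (e ∣? i))

  geomSum : ℕ → ℕ → Pol
  geomSum e m = mkP (m ℕ.* e) (divInd e)

  divInd-shift : ∀ e i → divInd e (e ℕ.+ i) ≈ divInd e i
  divInd-shift e i with e ∣? (e ℕ.+ i) | e ∣? i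
  ... | yes _ | yes _ = refl
  ... | no _ | no _ = refl
  ... | yes p | no ¬q = ⊥-elim (¬q (∣m+n∣m⇒∣n p ∣-refl))
  ... | no ¬p | yes q = ⊥-elim (¬p (∣m∣n⇒∣m+n ∣-refl q))

  divInd-yes : ∀ {e i} → e ∣ i → divInd e i ≈ 1#
  divInd-yes {e} {i} d rewrite dec-true (e ∣? i) d = refl

  divInd-no : ∀ {e i} → ¬ e ∣ i → divInd e i ≈ 0#
  divInd-no {e} {i} ¬d rewrite dec-false (e ∣? i) ¬d = refl

  -- among 0, ..., e-1 only 0 is divisible by e
  first-block : ∀ e → 1 ≤ e → mkP e (divInd e) ≋ oneₚ
  first-block e e≥1 = mk coeffwise
    where
    coeffwise : ∀ i → coeff (mkP e (divInd e)) i ≈ coeff oneₚ i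
    coeffwise zero = trans (reflexive (coeff-mk-lt e (divInd e) 0 e≥1)) (divInd-yes {e} {0} (divides 0 ≡.refl))
    coeffwise (suc i) with suc i ℕ.<? e
    ... | yes si<e = trans (reflexive (coeff-mk-lt e (divInd e) (suc i) si<e))
                           (divInd-no (λ d → ℕP.<-irrefl ≡.refl (ℕP.<-≤-trans si<e (∣⇒≤ d))))
    ... | no si≮e = reflexive (coeff-mk-ge e (divInd e) (suc i) (ℕP.≮⇒≥ si≮e))

  geomSum-suc : ∀ e m → 1 ≤ e → geomSum e (suc m) ≋ (oneₚ +ₚ (xPow e *ₚ geomSum e m))
  geomSum-suc e m e≥1 = ≋-trans (mk-split e (m ℕ.* e) (divInd e))
     (+-congₚ (first-block e e≥1) (*-congʳₚ (xPow e) (mk-cong (m ℕ.* e) (λ i _ → divInd-shift e i))))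

  geomSum-xm1 : ∀ e m → 1 ≤ e → (geomSum e m *ₚ xm1 e) ≋ xm1 (m ℕ.* e)
  geomSum-xm1 e zero e≥1 = mk λ { zero → sym (-‿inverseʳ 1#) ; (suc s) → refl }
  geomSum-xm1 e (suc m) e≥1 = ≋-trans (*-congˡₚ (xm1 e) (geomSum-suc e m e≥1))
    (≋-trans telescope (+-congₚ (≋-sym (xPow-+ e (m ℕ.* e))) ≋-refl))
    where
    open IntegerSolver PolRing using (solve; _:+_; _:*_; _:-_; _:=_; con)
    telescope : ((oneₚ +ₚ (xPow e *ₚ geomSum e m)) *ₚ xm1 e) ≋ ((xPow e *ₚ xPow (m ℕ.* e)) -ₚ oneₚ)
    telescope = ≋-trans (solve 3 (λ X P M → (con (+ 1) :+ X :* P) :* M := M :+ X :* (P :* M)) ≋-refl (xPow e) (geomSum e m) (xm1 e))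
      (≋-trans (+-congₚ {xm1 e} {xm1 e} ≋-refl (*-congʳₚ (xPow e) (geomSum-xm1 e m e≥1)))
        (solve 2 (λ X Y → (X :- con (+ 1)) :+ X :* (Y :- con (+ 1)) := X :* Y :- con (+ 1)) ≋-refl (xPow e) (xPow (m ℕ.* e))))

  -- P_e(m) ≡ m  (mod x^e - 1), as x^e ≡ 1
  geomSum-mod : ∀ e m → 1 ≤ e → geomSum e m ≡ cst (nat m) [mod xm1 e ]
  geomSum-mod e zero e≥1 = ≋⇒≡ (≋-sym cst-0)
  geomSum-mod e (suc m) e≥1 = ≡-≋ˡ (≋-sym (geomSum-suc e m e≥1))
     (≡-≋ʳ (≋-trans (+-congₚ {oneₚ} {oneₚ} ≋-refl (*-identityˡₚ (cst (nat m)))) (≋-sym (cst-+ 1# (nat m))))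
       (≡-+ (≡-refl {oneₚ}) (≡-* (xPow≡1 e) (geomSum-mod e m e≥1))))

module PolynomialCoprimality {c ℓ} (K : CommutativeRing c ℓ) where
  open import Level using (_⊔_)
  open import Data.List using ([])
  open Poly K
  open PolynomialRing K
  open PolynomialDivisibility K
  open IntegerSolver PolRing using (solve; _:+_; _:*_; _:=_)

  record Coprime (A B : Pol) : Set (c ⊔ ℓ) where
    constructor coprime
    field
      u v : Pol
      bezout : ((u *ₚ A) +ₚ (v *ₚ B)) ≋ oneₚ

  Coprime-sym : ∀ {A B} → Coprime A B → Coprime B A
  Coprime-sym {A} {B} (coprime u v e) = coprime v u (≋-trans (+-commₚ (v *ₚ B) (u *ₚ A)) e)

  Coprime-one : ∀ A → Coprime A oneₚ
  Coprime-one A = coprime [] oneₚ (*-identityˡₚ oneₚ)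

  -- multiply the two Bézout identities
  Coprime-* : ∀ {A B C} → Coprime A B → Coprime A C → Coprime A (B *ₚ C)
  Coprime-* {A} {B} {C} (coprime u₁ v₁ e₁) (coprime u₂ v₂ e₂) =
    coprime (((u₁ *ₚ u₂) *ₚ A) +ₚ ((u₁ *ₚ v₂) *ₚ C) +ₚ ((v₁ *ₚ B) *ₚ u₂)) (v₁ *ₚ v₂)
      (≋-trans (solve 7 (λ A B C u₁ v₁ u₂ v₂ →
          ((u₁ :* u₂) :* A :+ (u₁ :* v₂) :* C :+ (v₁ :* B) :* u₂) :* A :+ (v₁ :* v₂) :* (B :* C)
          := (u₁ :* A :+ v₁ :* B) :* (u₂ :* A :+ v₂ :* C)) ≋-refl A B C u₁ v₁ u₂ v₂)
        (≋-trans (*-congₚ e₁ e₂) (*-identityˡₚ oneₚ)))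

  -- a common multiple of coprime A and B is a multiple of A B:
  -- h = (u A + v B) h = (u r + v s) A B  if  h = s A = r B
  Coprime-div : ∀ {A B h} → Coprime A B → A ∣' h → B ∣' h → (A *ₚ B) ∣' h
  Coprime-div {A} {B} {h} (coprime u v e) (s , hs) (r , hr) = ((u *ₚ r) +ₚ (v *ₚ s)) ,
    ≋-trans (≋-sym (*-identityʳₚ h)) (≋-trans (*-congʳₚ h (≋-sym e))
      (≋-trans (solve 5 (λ h u v A B → h :* (u :* A :+ v :* B) := u :* A :* h :+ v :* B :* h) ≋-refl h u v A B)
        (≋-trans (+-congₚ (*-congʳₚ (u *ₚ A) hr) (*-congʳₚ (v *ₚ B) hs))
          (solve 6 (λ u v r s A B → u :* A :* (r :* B) :+ v :* B :* (s :* A) := (u :* r :+ v :* s) :* (A :* B)) ≋-refl u v r s A B))))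

module CyclotomicFacts {c ℓ} (K : CommutativeRing c ℓ) (Φ : ℕ → Poly.Pol K) (cyc : Poly.IsCyclotomicFamily K Φ) where
  open import Data.Nat as ℕ using (zero; suc; z≤n; s≤s)
  import Data.Nat.Properties as ℕP
  open import Data.Nat.Divisibility using (_∣?_; ∣-trans; ∣⇒≤; ∣-antisym; ∣-refl; m∣m*n; n∣m*n)
  open import Data.Bool using (Bool; true; false; _∧_; not)
  open import Data.List using (List; []; _∷_; _++_; map; filterᵇ)
  open import Data.List.Relation.Unary.All as All using (All; []; _∷_)
  open import Data.List.Membership.Propositional using (_∈_)
  open import Data.List.Membership.Propositional.Properties using (∈-filter⁺; ∈-applyUpTo⁺)
  open import Data.List.Relation.Unary.Any using (here; there)
  open import Relation.Binary.PropositionalEquality as ≡ using (_≡_; _≢_)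
  open import Data.Product using (Σ; proj₁; proj₂) renaming (_,_ to _,,_)
  open import Data.Empty using (⊥-elim)
  open import Relation.Nullary using (¬_; yes; no; does)
  open import Relation.Nullary.Decidable using (dec-true)
  open import Data.Integer using (+_)
  open import Function using (_∘_)
  open CommutativeRing K hiding (zero)
  open Poly K
  open PolynomialRing K
  open PolynomialDivisibility K
  open PolynomialFacts K
  open PolynomialCoprimality K
  open GeometricSums K
  open FilterOneTo
  open DecisionHelpers
  open IntegerSolver K using (nat)
  private module PS = IntegerSolver PolRing

  divides? : ℕ → ℕ → Bool
  divides? N d = does (d ∣? N)

  divisors : ℕ → List ℕ
  divisors N = filterᵇ (divides? N) (oneTo N)

  ΠΦ : List ℕ → Pol
  ΠΦ l = prodₚ (map Φ l)

  cyclotomic : ∀ N → 1 ≤ N → xm1 N ≋ ΠΦ (divisors N)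
  cyclotomic N N≥1 = mk (cyc N N≥1)

  ΠΦ-++ : ∀ xs ys → ΠΦ (xs ++ ys) ≋ (ΠΦ xs *ₚ ΠΦ ys)
  ΠΦ-++ [] ys = ≋-sym (*-identityˡₚ _)
  ΠΦ-++ (x ∷ xs) ys = ≋-trans (*-congʳₚ (Φ x) (ΠΦ-++ xs ys)) (≋-sym (*-assocₚ (Φ x) (ΠΦ xs) (ΠΦ ys)))

  ΠΦ-partition : ∀ (p : ℕ → Bool) l → ΠΦ l ≋ (ΠΦ (filterᵇ p l) *ₚ ΠΦ (filterᵇ (not ∘ p) l))
  ΠΦ-partition p [] = ≋-sym (*-identityˡₚ oneₚ)
  ΠΦ-partition p (x ∷ xs) with p x
  ... | true = ≋-trans (*-congʳₚ (Φ x) (ΠΦ-partition p xs)) (≋-sym (*-assocₚ (Φ x) _ _))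
  ... | false = ≋-trans (*-congʳₚ (Φ x) (ΠΦ-partition p xs))
       (PS.solve 3 (λ a b c → a PS.:* (b PS.:* c) PS.:= b PS.:* (a PS.:* c)) ≋-refl (Φ x) (ΠΦ (filterᵇ p xs)) (ΠΦ (filterᵇ (not ∘ p) xs)))

  Φ∣ΠΦ : ∀ {k l} → k ∈ l → Φ k ∣' ΠΦ l
  Φ∣ΠΦ {k} {x ∷ xs} (here ≡.refl) = ∣'-mulʳ (ΠΦ xs)
  Φ∣ΠΦ {k} {x ∷ xs} (there m) = ∣'-* (Φ x) (Φ∣ΠΦ m)

  ∈-divisors : ∀ {k N} → 1 ≤ k → 1 ≤ N → k ∣ N → k ∈ divisors N
  ∈-divisors {suc k} {N} _ N≥1 k∣N =
    ∈-filter⁺ _ (∈-applyUpTo⁺ suc (∣⇒≤ ⦃ ℕ.>-nonZero N≥1 ⦄ k∣N)) (T-yes (suc k ∣? N) k∣N)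

  Φ∣xm1 : ∀ {k N} → 1 ≤ k → 1 ≤ N → k ∣ N → Φ k ∣' xm1 N
  Φ∣xm1 k≥1 N≥1 k∣N = ∣'-cong (≋-sym (cyclotomic N N≥1)) (Φ∣ΠΦ (∈-divisors k≥1 N≥1 k∣N))
    where N = _

  divisors-divisors : ∀ a N → 1 ≤ a → a ∣ N → 1 ≤ N → filterᵇ (divides? a) (divisors N) ≡ divisors a
  divisors-divisors a N a≥1 a∣N N≥1 = ≡.trans (filterᵇ-filterᵇ (divides? a) (divides? N) (oneTo N))
      (≡.trans (≡.cong (λ x → filterᵇ both (oneTo x)) (≡.sym (ℕP.m+[n∸m]≡n a≤N)))
      (≡.trans (filterᵇ-oneTo-extend both a (N ℕ.∸ a) beyond-a)
        (filterᵇ-oneTo-ext both (divides? a) a up-to-a)))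
    where
    a≤N = ∣⇒≤ ⦃ ℕ.>-nonZero N≥1 ⦄ a∣N
    both : ℕ → Bool
    both d = divides? a d ∧ divides? N d
    beyond-a : ∀ d → a < d → d ≤ a ℕ.+ (N ℕ.∸ a) → both d ≡ false
    beyond-a d a<d _ with d ∣? a
    ... | yes d∣a = ⊥-elim (ℕP.<-irrefl ≡.refl (ℕP.<-≤-trans a<d (∣⇒≤ ⦃ ℕ.>-nonZero a≥1 ⦄ d∣a)))
    ... | no _ = ≡.refl
    up-to-a : ∀ d → 1 ≤ d → d ≤ a → both d ≡ divides? a d
    up-to-a d _ _ with d ∣? a
    ... | no _ = ≡.refl
    ... | yes d∣a = dec-true (d ∣? N) (∣-trans d∣a a∣N)

  -- Φ_b ∣ P_a(m) when b ∣ ma and b ∤ a: since P_a(m) (x^a - 1) = x^{ma} - 1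
  -- = (x^a - 1) Π_{d ∣ ma, d ∤ a} Φ_d and x^a - 1 can be cancelled
  Φ∣geomSum : ∀ a m b → 1 ≤ a → 1 ≤ m → 1 ≤ b → b ∣ m ℕ.* a → ¬ (b ∣ a) → Φ b ∣' geomSum a m
  Φ∣geomSum a m b a≥1 m≥1 b≥1 b∣N b∤a = ∣'-cong (≋-sym geomSum≈Rest) (Φ∣ΠΦ b∈Rest)
    where
    N = m ℕ.* a
    N≥1 : 1 ≤ N
    N≥1 = ℕP.*-mono-≤ m≥1 a≥1
    Rest = ΠΦ (filterᵇ (not ∘ divides? a) (divisors N))
    split : xm1 N ≋ (xm1 a *ₚ Rest)
    split = ≋-trans (cyclotomic N N≥1) (≋-trans (ΠΦ-partition (divides? a) (divisors N))
      (*-congˡₚ {ΠΦ (filterᵇ (divides? a) (divisors N))} Rest (≋-trans (mk λ s → reflexive (≡.cong (λ l → coeff (ΠΦ l) s) (divisors-divisors a N a≥1 (n∣m*n m) N≥1)))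
                              (≋-sym (cyclotomic a a≥1)))))
    difference≈0 : ((geomSum a m -ₚ Rest) *ₚ xm1 a) ≋ []
    difference≈0 = ≋-trans (*-distribʳₚ (xm1 a) (geomSum a m) (-ₚ Rest))
      (≋-trans (+-congₚ (≋-trans (geomSum-xm1 a m a≥1) split) (≋-refl {(-ₚ Rest) *ₚ xm1 a}))
        (PS.solve 2 (λ A R → A PS.:* R PS.:+ (PS.:- R) PS.:* A PS.:= PS.con (+ 0)) ≋-refl (xm1 a) Rest))
    geomSum≈Rest : geomSum a m ≋ Rest
    geomSum≈Rest = mk λ s → x-y≈0⇒x≈y (trans (sym (coeff-- (geomSum a m) Rest s))
      (xm1-cancel a (geomSum a m -ₚ Rest) a≥1 (get difference≈0) s))
    b∈Rest : b ∈ filterᵇ (not ∘ divides? a) (divisors N)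
    b∈Rest = ∈-filter⁺ _ (∈-divisors b≥1 N≥1 b∣N) (T-no (b ∣? a) b∤a)

  module _ (inv : ∀ b → 1 ≤ b → Σ Carrier (λ y → y * nat b ≈ 1#)) where

    -- if b ∤ a then, with P = P_a(b):  Φ_b ∣ P  and  Φ_a ∣ P - b,
    -- so  b⁻¹ (P - (P - b)) = 1  is a combination of Φ_a and Φ_b
    Coprime-Φ-half : ∀ a b → 1 ≤ a → 1 ≤ b → ¬ (b ∣ a) → Coprime (Φ a) (Φ b)
    Coprime-Φ-half a b a≥1 b≥1 b∤a = coprime (-ₚ (cst y *ₚ u)) (cst y *ₚ v) combination
      where
      P = geomSum a b
      y = proj₁ (inv b b≥1)
      Φb∣P : Φ b ∣' P
      Φb∣P = Φ∣geomSum a b b a≥1 b≥1 b≥1 (m∣m*n a) b∤a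
      Φa∣P-b : Φ a ∣' (P -ₚ cst (nat b))
      Φa∣P-b = getcg (≡-weaken (Φ∣xm1 a≥1 a≥1 ∣-refl) (geomSum-mod a b a≥1))
      v = _∣'_.quo Φb∣P
      u = _∣'_.quo Φa∣P-b
      combination : (((-ₚ (cst y *ₚ u)) *ₚ Φ a) +ₚ ((cst y *ₚ v) *ₚ Φ b)) ≋ oneₚ
      combination = ≋-trans (PS.solve 5 (λ Y u v A B → (PS.:- (Y PS.:* u)) PS.:* A PS.:+ (Y PS.:* v) PS.:* B
                                                      PS.:= Y PS.:* (v PS.:* B PS.:- u PS.:* A)) ≋-refl (cst y) u v (Φ a) (Φ b))
        (≋-trans (*-congʳₚ (cst y) (+-congₚ (≋-sym (_∣'_.quo-eq Φb∣P)) (neg-congₚ (≋-sym (_∣'_.quo-eq Φa∣P-b)))))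
        (≋-trans (*-congʳₚ (cst y) (PS.solve 2 (λ P c → P PS.:+ PS.:- (P PS.:- c) PS.:= c) ≋-refl P (cst (nat b))))
        (≋-trans (≋-sym (cst-mul y (nat b))) (cst-cong (proj₂ (inv b b≥1))))))

    Coprime-Φ : ∀ a b → 1 ≤ a → 1 ≤ b → a ≢ b → Coprime (Φ a) (Φ b)
    Coprime-Φ a b a≥1 b≥1 a≢b with b ∣? a
    ... | no b∤a = Coprime-Φ-half a b a≥1 b≥1 b∤a
    ... | yes b∣a = Coprime-sym (Coprime-Φ-half b a b≥1 a≥1 (λ a∣b → a≢b (∣-antisym a∣b b∣a)))

    Coprime-ΠΦ : ∀ {A} l → All (λ k → Coprime A (Φ k)) l → Coprime A (ΠΦ l)
    Coprime-ΠΦ [] [] = Coprime-one _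
    Coprime-ΠΦ (k ∷ l) (c ∷ cs) = Coprime-* c (Coprime-ΠΦ l cs)

    -- if Φ_k ∣ h for every selected k ≤ B, then so does their product,
    -- by induction on B using coprimality of Φ_{B+1} with the earlier ones
    ΠΦ-filter-∣ : ∀ h (p : ℕ → Bool) B → (∀ k → InRange B k → p k ≡ true → Φ k ∣' h) → ΠΦ (filterᵇ p (oneTo B)) ∣' h
    ΠΦ-filter-∣ h p zero hyp = h , ≋-sym (*-identityʳₚ h)
    ΠΦ-filter-∣ h p (suc B) hyp rewrite filterᵇ-oneTo-suc p B with p (suc B) in eq
    ... | false = ∣'-congˡ (≋-sym (≋-trans (ΠΦ-++ L []) (*-identityʳₚ (ΠΦ L)))) ih
      where
      L = filterᵇ p (oneTo B)
      ih = ΠΦ-filter-∣ h p B (λ k (k≥1 ,, k≤B) e → hyp k (k≥1 ,, ℕP.m≤n⇒m≤1+n k≤B) e)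
    ... | true = ∣'-congˡ (≋-sym (≋-trans (ΠΦ-++ L (suc B ∷ []))
                 (≋-trans (*-congʳₚ (ΠΦ L) (*-identityʳₚ (Φ (suc B)))) (*-commₚ (ΠΦ L) (Φ (suc B))))))
                 (Coprime-div coprime-L (hyp (suc B) (s≤s z≤n ,, ℕP.≤-refl) eq) ih)
      where
      L = filterᵇ p (oneTo B)
      ih = ΠΦ-filter-∣ h p B (λ k (k≥1 ,, k≤B) e → hyp k (k≥1 ,, ℕP.m≤n⇒m≤1+n k≤B) e)
      coprime-L : Coprime (Φ (suc B)) (ΠΦ L)
      coprime-L = Coprime-ΠΦ L (All.map (λ { (k≥1 ,, k≤B) → Coprime-Φ (suc B) _ (s≤s z≤n) k≥1
                                                           (λ e → ℕP.<-irrefl (≡.sym e) (s≤s k≤B)) })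
                                        (all-filterᵇ-oneTo p B))

    xm1-∣ : ∀ N h → 1 ≤ N → (∀ k → 1 ≤ k → k ∣ N → Φ k ∣' h) → xm1 N ∣' h
    xm1-∣ N h N≥1 hyp = ∣'-congˡ (≋-sym (cyclotomic N N≥1))
      (ΠΦ-filter-∣ h (divides? N) N (λ k (k≥1 ,, _) e → hyp k k≥1 (witness (k ∣? N) e)))

module PolynomialExpansions {c ℓ} (K : CommutativeRing c ℓ) where
  open import Data.Nat as ℕ using (zero; suc; s≤s)
  import Data.Nat.Properties as ℕP
  open import Data.List using ([]; length)
  open import Relation.Binary.PropositionalEquality as ≡ using (_≡_; _≢_)
  open import Relation.Binary.Definitions using (tri<; tri≈; tri>)
  open import Relation.Nullary using (yes; no)
  open import Data.Product using (_,_)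
  open import Data.Empty using (⊥-elim)
  open CommutativeRing K hiding (zero)
  open Poly K
  open PolynomialRing K
  open PolynomialDivisibility K
  open PolynomialFacts K
  open import Algebra.Properties.Ring ring using (-0#≈0#; -‿distribʳ-*)
  open import Relation.Binary.Reasoning.Setoid setoid

  monomial-expansion : ∀ a → a ≋ ΣP (length a) (λ s → cst (coeff a s) *ₚ xPow s)
  monomial-expansion a = mk λ i → sym (trans (coeff-Σ (length a) term i) (pick i))
    where
    L = length a
    term = λ s → cst (coeff a s) *ₚ xPow s
    off-diagonal : ∀ i s → s ≢ i → coeff (term s) i ≈ 0#
    off-diagonal i s s≢i = trans (coeff-cst* (coeff a s) (xPow s) i) (trans (*-congˡ (coeff-xPow-diff s i s≢i)) (zeroʳ _))
    pick : ∀ i → ΣK L (λ s → coeff (term s) i) ≈ coeff a i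
    pick i with i ℕ.<? L
    ... | yes i<L = trans (ΣK-delta L _ i i<L (λ s _ → off-diagonal i s))
                          (trans (coeff-cst* (coeff a i) (xPow i) i) (trans (*-congˡ (coeff-xPow-same i)) (*-identityʳ _)))
    ... | no i≮L = trans (ΣK-zero L (λ s s<L → off-diagonal i s (λ e → i≮L (≡.subst (_< L) e s<L))))
                         (sym (coeff-len a i (ℕP.≮⇒≥ i≮L)))

  rotate : ℕ → (ℕ → Carrier) → ℕ → Carrier
  rotate n' g zero = g n'
  rotate n' g (suc i) = g i

  private
    x-0≈x : ∀ x → x - 0# ≈ x
    x-0≈x x = trans (+-congˡ -0#≈0#) (+-identityʳ x)

  window-rotation : ∀ n' g → (X (mkP (suc n') g) -ₚ mkP (suc n') (rotate n' g)) ≋ (cst (g n') *ₚ xm1 (suc n'))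
  window-rotation n' g = mk λ j → trans (trans (coeff-- (X (mkP n g)) (mkP n (rotate n' g)) j) (by-index j))
                                        (sym (trans (coeff-cst* (g n') (xm1 n) j) (*-congˡ (coeff-- (xPow n) oneₚ j))))
    where
    n = suc n'
    by-index : ∀ j → coeff (X (mkP n g)) j - coeff (mkP n (rotate n' g)) j ≈ g n' * (coeff (xPow n) j - coeff oneₚ j)
    by-index zero = begin
      0# - g n'             ≈⟨ +-identityˡ _ ⟩
      - g n'                ≈⟨ -‿cong (sym (*-identityʳ _)) ⟩
      - (g n' * 1#)         ≈⟨ -‿distribʳ-* _ _ ⟩
      g n' * - 1#           ≈⟨ *-congˡ (sym (+-identityˡ _)) ⟩
      g n' * (0# - 1#)      ∎
    by-index (suc i) with ℕP.<-cmp i n'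
    ... | tri< i<n' _ _ = begin
      coeff (mkP n g) i - coeff (mkP n (rotate n' g)) (suc i) ≡⟨ ≡.cong₂ _-_ (coeff-mk-lt n g i (ℕP.m<n⇒m<1+n i<n'))
                                                                              (coeff-mk-lt n _ (suc i) (s≤s i<n')) ⟩
      g i - g i                          ≈⟨ -‿inverseʳ _ ⟩
      0#                                 ≈⟨ sym (zeroʳ _) ⟩
      g n' * 0#                          ≈⟨ *-congˡ (sym (trans (x-0≈x _) (coeff-xPow-diff n' i (λ e → ℕP.<-irrefl (≡.sym e) i<n')))) ⟩
      g n' * (coeff (xPow n') i - 0#)    ∎
    ... | tri≈ _ ≡.refl _ = begin
      coeff (mkP n g) i - coeff (mkP n (rotate n' g)) (suc i) ≡⟨ ≡.cong₂ _-_ (coeff-mk-lt n g i ℕP.≤-refl)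
                                                                              (coeff-mk-ge n _ (suc i) ℕP.≤-refl) ⟩
      g i - 0#                           ≈⟨ x-0≈x _ ⟩
      g i                                ≈⟨ sym (*-identityʳ _) ⟩
      g i * 1#                           ≈⟨ *-congˡ (sym (trans (x-0≈x _) (coeff-xPow-same i))) ⟩
      g i * (coeff (xPow i) i - 0#)      ∎
    ... | tri> _ _ i>n' = begin
      coeff (mkP n g) i - coeff (mkP n (rotate n' g)) (suc i) ≡⟨ ≡.cong₂ _-_ (coeff-mk-ge n g i i>n')
                                                                              (coeff-mk-ge n _ (suc i) (ℕP.m≤n⇒m≤1+n i>n')) ⟩
      0# - 0#                            ≈⟨ -‿inverseʳ _ ⟩
      0#                                 ≈⟨ sym (zeroʳ _) ⟩
      g n' * 0#                          ≈⟨ *-congˡ (sym (trans (x-0≈x _) (coeff-xPow-diff n' i (λ e → ℕP.<-irrefl e i>n')))) ⟩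
      g n' * (coeff (xPow n') i - 0#)    ∎

  rotate-≡-X : ∀ n' g → mkP (suc n') (rotate n' g) ≡ X (mkP (suc n') g) [mod xm1 (suc n') ]
  rotate-≡-X n' g = ≡-sym (cg (cst (g n') , window-rotation n' g))

  ΣP-single-mod : ∀ n (g : ℕ → Pol) k {M} → k < n → (∀ j → j < n → j ≢ k → g j ≡ [] [mod M ]) → ΣP n g ≡ g k [mod M ]
  ΣP-single-mod n g k {M} k<n others = ≡-≋ʳ (≋-trans (ΣP-delta n (selected) k k<n (λ j _ j≢k → unselected j j≢k)) (selected-k))
                                          (ΣP-mod n g selected (λ j j<n → keep j j<n))
    where
    selected : ℕ → Pol
    selected j with j ℕ.≟ k
    ... | yes _ = g j
    ... | no _ = []
    keep : ∀ j → j < n → g j ≡ selected j [mod M ]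
    keep j j<n with j ℕ.≟ k
    ... | yes _ = ≡-refl
    ... | no j≢k = others j j<n j≢k
    unselected : ∀ j → j ≢ k → selected j ≋ []
    unselected j j≢k with j ℕ.≟ k
    ... | yes j≡k = ⊥-elim (j≢k j≡k)
    ... | no _ = ≋-refl
    selected-k : selected k ≋ g k
    selected-k with k ℕ.≟ k
    ... | yes _ = ≋-refl
    ... | no k≢k = ⊥-elim (k≢k ≡.refl)

module MobiusFunction where
  open import Data.Nat as ℕ using (zero; suc; z≤n; s≤s; _≟_)
  import Data.Nat.Properties as ℕP
  open import Data.Nat.Divisibility
  open import Data.Nat.Primality using (Prime; prime?; prime⇒irreducible; prime⇒nonTrivial; prime⇒nonZero; euclidsLemma)
  open import Data.Nat.Coprimality using (Coprime; coprime-divisor)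
  open import Data.Bool using (Bool; true; false; _∧_; _∨_; if_then_else_)
  open import Data.List using (List; []; _∷_; _++_; filterᵇ; upTo; length; foldr)
  import Data.List.Properties as LP
  open import Data.List.Membership.Propositional using (_∈_)
  open import Data.List.Membership.Propositional.Properties using (∈-upTo⁺)
  open import Data.List.Relation.Unary.Any using (here; there)
  open import Data.Integer as ℤ using (ℤ; +_)
  import Data.Integer.Properties as ℤP
  open import Relation.Binary.PropositionalEquality as ≡ using (_≡_; refl; cong; sym; trans; subst)
  open import Data.Product using (Σ; _,_)
  open import Data.Sum using (inj₁; inj₂)
  open import Data.Empty using (⊥; ⊥-elim)
  open import Relation.Nullary using (¬_; yes; no; does)
  import Data.Bool.Properties
  open import Relation.Nullary.Decidable using (dec-true; dec-false)
  import Data.Nat.Solver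
  open import Data.Bool using (T?)
  open import Function using (_∘_)
  open DecisionHelpers using (witness)

  count : ℕ → (ℕ → Bool) → ℕ
  count zero P = 0
  count (suc B) P = count B P ℕ.+ (if P B then 1 else 0)

  upTo-snoc : ∀ B → upTo (suc B) ≡ upTo B ++ (B ∷ [])
  upTo-snoc B = sym (LP.applyUpTo-∷ʳ (λ x → x) B)

  length-filter-upTo : ∀ (P : ℕ → Bool) B → length (filterᵇ P (upTo B)) ≡ count B P
  length-filter-upTo P zero = refl
  length-filter-upTo P (suc B) = trans (cong (λ l → length (filterᵇ P l)) (upTo-snoc B))
     (trans (cong length (LP.filter-++ (T? ∘ P) (upTo B) (B ∷ [])))
     (trans (LP.length-++ (filterᵇ P (upTo B)))
     (≡.cong₂ ℕ._+_ (length-filter-upTo P B) single)))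
    where
    single : length (filterᵇ P (B ∷ [])) ≡ (if P B then 1 else 0)
    single with P B
    ... | true = refl
    ... | false = refl

  count-ext : ∀ (P Q : ℕ → Bool) B → (∀ i → i < B → P i ≡ Q i) → count B P ≡ count B Q
  count-ext P Q zero e = refl
  count-ext P Q (suc B) e rewrite count-ext P Q B (λ i i<B → e i (ℕP.m<n⇒m<1+n i<B)) | e B ℕP.≤-refl = refl

  count-extend : ∀ (P : ℕ → Bool) B k → (∀ i → B ≤ i → P i ≡ false) → count (B ℕ.+ k) P ≡ count B P
  count-extend P B zero e rewrite ℕP.+-identityʳ B = refl
  count-extend P B (suc k) e rewrite ℕP.+-suc B k | e (B ℕ.+ k) (ℕP.m≤m+n B k) | ℕP.+-identityʳ (count (B ℕ.+ k) P) = count-extend P B k e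

  orElement : (ℕ → Bool) → ℕ → ℕ → Bool
  orElement P p q = P q ∨ does (q ≟ p)

  orElement-other : ∀ P p q → ¬ (q ≡ p) → orElement P p q ≡ P q
  orElement-other P p q ne rewrite dec-false (q ≟ p) ne = Data.Bool.Properties.∨-identityʳ (P q)

  orElement-self : ∀ P p → orElement P p p ≡ (P p ∨ true)
  orElement-self P p rewrite dec-true (p ≟ p) refl = refl

  count-orElement-below : ∀ P p B → B ≤ p → count B (orElement P p) ≡ count B P
  count-orElement-below P p B B≤p = count-ext (orElement P p) P B (λ i i<B → orElement-other P p i (λ i≡p → ℕP.<-irrefl i≡p (ℕP.<-≤-trans i<B B≤p)))

  count-orElement : ∀ (P : ℕ → Bool) p B → P p ≡ false → p < B → count B (orElement P p) ≡ suc (count B P)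
  count-orElement P p zero Pp ()
  count-orElement P p (suc B) Pp p<sB with p ≟ B
  ... | yes refl rewrite count-orElement-below P p p ℕP.≤-refl | orElement-self P p | Pp | ℕP.+-identityʳ (count p P) = ℕP.+-comm (count p P) 1
  ... | no p≢B rewrite count-orElement P p B Pp (ℕP.≤∧≢⇒< (ℕP.≤-pred p<sB) p≢B) | orElement-other P p B (λ e → p≢B (sym e)) = refl

  prime≥2 : ∀ {p} → Prime p → 2 ≤ p
  prime≥2 {p} pp = ℕ.nonTrivial⇒n>1 p ⦃ prime⇒nonTrivial pp ⦄

  prime∣prime : ∀ {p q} → Prime p → Prime q → q ∣ p → q ≡ p
  prime∣prime {p} {q} pp pq q∣p with prime⇒irreducible pp q∣p
  ... | inj₂ e = e
  ... | inj₁ refl = ⊥-elim (ℕP.<-irrefl refl (prime≥2 pq))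

  coprime-from-prime : ∀ {p d} → Prime p → ¬ (p ∣ d) → Coprime d p
  coprime-from-prime {p} {d} pp p∤d (e∣d , e∣p) with prime⇒irreducible pp e∣p
  ... | inj₁ e≡1 = e≡1
  ... | inj₂ refl = ⊥-elim (p∤d e∣d)

  primeDivisor? : ℕ → ℕ → Bool
  primeDivisor? m q = does (prime? q) ∧ does (q ∣? m)

  numPrimeDivisors-count : ∀ m → numPrimeDivisors m ≡ count (suc m) (primeDivisor? m)
  numPrimeDivisors-count m = length-filter-upTo (primeDivisor? m) (suc m)

  primeDivisor?-p*g : ∀ {p g} → Prime p → ¬ (p ∣ g) → ∀ q → primeDivisor? (p ℕ.* g) q ≡ orElement (primeDivisor? g) p q
  primeDivisor?-p*g {p} {g} pp p∤g q with prime? q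
  ... | no ¬pq = sym (dec-false (q ≟ p) (λ { refl → ¬pq pp }))
  ... | yes pq with q ∣? (p ℕ.* g) | q ∣? g
  ... | yes _ | yes _ = refl
  ... | yes d | no ¬qg with euclidsLemma p g pq d
  ...   | inj₁ q∣p = sym (dec-true (q ≟ p) (prime∣prime pp pq q∣p))
  ...   | inj₂ q∣g = ⊥-elim (¬qg q∣g)
  primeDivisor?-p*g {p} {g} pp p∤g q | yes pq | no ¬d | yes qg = ⊥-elim (¬d (∣n⇒∣m*n p qg))
  primeDivisor?-p*g {p} {g} pp p∤g q | yes pq | no ¬d | no _ = sym (dec-false (q ≟ p) (λ { refl → ¬d (m∣m*n g) }))

  numPrimeDivisors-p*g : ∀ {p g} → Prime p → ¬ (p ∣ g) → 1 ≤ g → numPrimeDivisors (p ℕ.* g) ≡ suc (numPrimeDivisors g)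
  numPrimeDivisors-p*g {p} {g} pp p∤g g≥1 = begin
    numPrimeDivisors (p ℕ.* g) ≡⟨ numPrimeDivisors-count (p ℕ.* g) ⟩
    count (suc (p ℕ.* g)) (primeDivisor? (p ℕ.* g)) ≡⟨ count-ext _ _ (suc (p ℕ.* g)) (λ i _ → primeDivisor?-p*g pp p∤g i) ⟩
    count (suc (p ℕ.* g)) (orElement (primeDivisor? g) p) ≡⟨ count-orElement (primeDivisor? g) p (suc (p ℕ.* g)) Pp (s≤s p≤pg) ⟩
    suc (count (suc (p ℕ.* g)) (primeDivisor? g)) ≡⟨ cong suc (trans (cong (λ x → count x (primeDivisor? g)) (sym eqB)) (count-extend (primeDivisor? g) (suc g) (p ℕ.* g ℕ.∸ g) big)) ⟩
    suc (count (suc g) (primeDivisor? g)) ≡⟨ cong suc (sym (numPrimeDivisors-count g)) ⟩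
    suc (numPrimeDivisors g) ∎
    where
    open ≡.≡-Reasoning
    p≥1 : 1 ≤ p
    p≥1 = ℕP.≤-trans (s≤s z≤n) (prime≥2 pp)
    p≤pg : p ≤ p ℕ.* g
    p≤pg = ℕP.≤-trans (ℕP.≤-reflexive (sym (ℕP.*-identityʳ p))) (ℕP.*-monoʳ-≤ p g≥1)
    g≤pg : g ≤ p ℕ.* g
    g≤pg = ℕP.≤-trans (ℕP.≤-reflexive (sym (ℕP.*-identityˡ g))) (ℕP.*-monoˡ-≤ g p≥1)
    eqB : suc g ℕ.+ (p ℕ.* g ℕ.∸ g) ≡ suc (p ℕ.* g)
    eqB = cong suc (ℕP.m+[n∸m]≡n g≤pg)
    Pp : primeDivisor? g p ≡ false
    Pp with prime? p
    ... | no _ = refl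
    ... | yes _ = dec-false (p ∣? g) p∤g
    big : ∀ i → suc g ≤ i → primeDivisor? g i ≡ false
    big i sg≤i with prime? i
    ... | no _ = refl
    ... | yes _ = dec-false (i ∣? g) (λ i∣g → ℕP.<-irrefl refl (ℕP.<-≤-trans sg≤i (∣⇒≤ ⦃ ℕ.>-nonZero g≥1 ⦄ i∣g)))

  squareDivisor? : ℕ → ℕ → Bool
  squareDivisor? m d = does (2 ℕ.≤? d) ∧ does ((d ℕ.* d) ∣? m)

  any-intro : ∀ (P : ℕ → Bool) l d → d ∈ l → P d ≡ true → foldr (λ d b → P d ∨ b) false l ≡ true
  any-intro P (x ∷ l) d (here refl) e rewrite e = refl
  any-intro P (x ∷ l) d (there m) e rewrite any-intro P l d m e = Data.Bool.Properties.∨-zeroʳ (P x)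

  any-elim : ∀ (P : ℕ → Bool) l → foldr (λ d b → P d ∨ b) false l ≡ true → Σ ℕ (λ d → d ∈ l × P d ≡ true)
  any-elim P [] ()
  any-elim P (x ∷ l) e with P x in eq
  ... | true = x , here refl , eq
  ... | false with any-elim P l e
  ...   | d , m , e' = d , there m , e'

  ∧-true : ∀ {a b} → (a ∧ b) ≡ true → a ≡ true × b ≡ true
  ∧-true {true} {true} _ = refl , refl

  d≤d*d : ∀ d → d ≤ d ℕ.* d
  d≤d*d zero = z≤n
  d≤d*d (suc d) = ℕP.m≤m*n (suc d) (suc d)

  squareFactor-intro : ∀ {m d} → 2 ≤ d → (d ℕ.* d) ∣ m → 1 ≤ m → squareFactor m ≡ true
  squareFactor-intro {m} {d} d≥2 dd∣m m≥1 = any-intro (squareDivisor? m) (upTo (suc m)) d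
    (∈-upTo⁺ (s≤s (ℕP.≤-trans (d≤d*d d) (∣⇒≤ ⦃ ℕ.>-nonZero m≥1 ⦄ dd∣m))))
    (≡.cong₂ _∧_ (dec-true (2 ℕ.≤? d) d≥2) (dec-true ((d ℕ.* d) ∣? m) dd∣m))

  squareFactor-elim : ∀ {m} → squareFactor m ≡ true → Σ ℕ (λ d → 2 ≤ d × (d ℕ.* d) ∣ m)
  squareFactor-elim {m} e with any-elim (squareDivisor? m) (upTo (suc m)) e
  ... | d , _ , e' with ∧-true {does (2 ℕ.≤? d)} e'
  ...   | e1 , e2 = d , witness (2 ℕ.≤? d) e1 , witness ((d ℕ.* d) ∣? m) e2

  square-divides : ∀ {p g d} → Prime p → ¬ (p ∣ g) → 2 ≤ d → (d ℕ.* d) ∣ (p ℕ.* g) → (d ℕ.* d) ∣ g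
  square-divides {p} {g} {d} pp p∤g d≥2 dd∣pg with p ∣? d
  ... | yes (divides k refl) = ⊥-elim (p∤g (*-cancelˡ-∣ p ⦃ prime⇒nonZero pp ⦄ pp∣pg))
    where
    pp∣dd : p ℕ.* p ∣ (k ℕ.* p) ℕ.* (k ℕ.* p)
    pp∣dd = divides (k ℕ.* k) regroup
      where
      regroup : (k ℕ.* p) ℕ.* (k ℕ.* p) ≡ (k ℕ.* k) ℕ.* (p ℕ.* p)
      regroup = Data.Nat.Solver.+-*-Solver.solve 2 (λ k p → (k :* p) :* (k :* p) := (k :* k) :* (p :* p)) refl k p
        where open Data.Nat.Solver.+-*-Solver using (_:*_; _:=_)
    pp∣pg : p ℕ.* p ∣ p ℕ.* g
    pp∣pg = ∣-trans pp∣dd dd∣pg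
  ... | no p∤d = dd∣g
    where
    instance
      _ : NonZero d
      _ = ℕ.>-nonZero (ℕP.<-trans (s≤s z≤n) d≥2)
    cop : Coprime d p
    cop = coprime-from-prime pp p∤d
    d∣g : d ∣ g
    d∣g = coprime-divisor cop (∣-trans (m∣m*n d) dd∣pg)
    g1 = quotient d∣g
    g≡ : g ≡ g1 ℕ.* d
    g≡ = _∣_.equality d∣g
    d∣pg1 : d ∣ p ℕ.* g1
    d∣pg1 = *-cancelʳ-∣ d (subst (d ℕ.* d ∣_) (trans (cong (p ℕ.*_) g≡) (sym (ℕP.*-assoc p g1 d))) dd∣pg)
    d∣g1 : d ∣ g1
    d∣g1 = coprime-divisor cop d∣pg1
    dd∣g : d ℕ.* d ∣ g
    dd∣g = subst (d ℕ.* d ∣_) (sym g≡) (≡.subst (λ x → d ℕ.* d ∣ x) (ℕP.*-comm d g1) (*-monoʳ-∣ d d∣g1))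

  private
    true≢false : true ≡ false → ⊥
    true≢false ()

  squareFactor-p*g : ∀ {p g} → Prime p → ¬ (p ∣ g) → 1 ≤ g → squareFactor (p ℕ.* g) ≡ squareFactor g
  squareFactor-p*g {p} {g} pp p∤g g≥1 with squareFactor g in e1 | squareFactor (p ℕ.* g) in e2
  ... | true | true = refl
  ... | false | false = refl
  ... | true | false with squareFactor-elim {g} e1
  ...   | d , d≥2 , dd∣g = ⊥-elim (true≢false (trans (sym (squareFactor-intro d≥2 (∣n⇒∣m*n p dd∣g) pg≥1)) e2))
    where
    pg≥1 : 1 ≤ p ℕ.* g
    pg≥1 = ℕP.*-mono-≤ (ℕP.≤-trans (s≤s z≤n) (prime≥2 pp)) g≥1
  squareFactor-p*g {p} {g} pp p∤g g≥1 | false | true with squareFactor-elim {p ℕ.* g} e2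
  ... | d , d≥2 , dd∣pg = ⊥-elim (true≢false (trans (sym (squareFactor-intro d≥2 (square-divides pp p∤g d≥2 dd∣pg) g≥1)) e1))

  μ-pg : ∀ {p g} → Prime p → ¬ (p ∣ g) → 1 ≤ g → μ (p ℕ.* g) ≡ ℤ.- μ g
  μ-pg {p} {g} pp p∤g g≥1 rewrite squareFactor-p*g pp p∤g g≥1 | numPrimeDivisors-p*g pp p∤g g≥1 with squareFactor g
  ... | true = refl
  ... | false = ℤP.-1*i≡-i _

  μ-sq : ∀ {p g} → Prime p → (p ℕ.* p) ∣ g → 1 ≤ g → μ g ≡ + 0
  μ-sq {p} {g} pp pp∣g g≥1 rewrite squareFactor-intro (prime≥2 pp) pp∣g g≥1 = refl

module MobiusSums where
  open import Data.Nat as ℕ using (zero; suc; z≤n; s≤s; _≟_)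
  import Data.Nat.Properties as ℕP
  open import Data.Nat.Divisibility
  open import Data.Nat.DivMod using (_/_; m*n/n≡m; m*n/o*n≡m/o)
  open import Data.Nat.Primality using (Prime; prime⇒nonZero)
  open import Data.Nat.Primality.Factorisation using (factorise)
  open import Data.Bool using (Bool; true; false; _∧_; if_then_else_; not)
  import Data.Bool.Properties as BoolP
  open import Data.Integer as ℤ using (ℤ; +_)
  import Data.Integer.Properties as ℤP
  open import Relation.Binary.PropositionalEquality as ≡ using (_≡_; refl; cong; sym; trans; subst; cong₂)
  open import Data.Product using (Σ; _,_)
  open import Data.Empty using (⊥-elim)
  open import Relation.Nullary using (¬_; yes; no; Dec; does)
  open import Relation.Nullary.Decidable using (dec-true; dec-false)
  open import Data.List using ([]; _∷_)
  open import Data.List.Relation.Unary.All using (_∷_)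
  open import Data.Nat.Coprimality using (coprime-divisor)
  open MobiusFunction using (μ-pg; μ-sq; prime≥2; coprime-from-prime)
  open FiniteSums ℤP.+-*-commutativeRing public using ()
    renaming (Σ' to ΣZ; Σ-cong' to ΣZ-cong'; Σ-+ to ΣZ-+; Σ-split to ΣZ-split; Σ-shift to ΣZ-shift;
              Σ-swap to ΣZ-swap; Σ-delta to ΣZ-delta; Σ-zero to ΣZ-zero; Σ-neg to ΣZ-neg)

  I : Bool → ℤ → ℤ
  I b x = if b then x else + 0

  dv : ℕ → ℕ → Bool
  dv a b = does (a ∣? b)

  I-no : ∀ {A : Set} (d : Dec A) x → ¬ A → I (does d) x ≡ + 0
  I-no d x ¬a rewrite dec-false d ¬a = refl

  I-yes : ∀ {A : Set} (d : Dec A) x → A → I (does d) x ≡ x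
  I-yes d x a rewrite dec-true d a = refl

  I-∧-no : ∀ {A : Set} (d : Dec A) b x → ¬ A → I (does d ∧ b) x ≡ + 0
  I-∧-no d b x ¬a rewrite dec-false d ¬a = refl

  first-multiple : ∀ k (g : ℕ → ℤ) → 1 ≤ k → ΣZ k (λ j → I (dv k (suc j)) (g (suc j))) ≡ g k
  first-multiple (suc k') g _ = trans (ΣZ-delta (suc k') _ k' ℕP.≤-refl zero-elsewhere) (I-yes (suc k' ∣? suc k') _ ∣-refl)
    where
    zero-elsewhere : ∀ j → j < suc k' → ¬ (j ≡ k') → I (dv (suc k') (suc j)) (g (suc j)) ≡ + 0
    zero-elsewhere j j<sk j≢k = I-no (suc k' ∣? suc j) _ (λ d → ℕP.<-irrefl refl (ℕP.<-≤-trans (s≤s (ℕP.≤∧≢⇒< (ℕP.≤-pred j<sk) j≢k)) (∣⇒≤ d)))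

  dv-shift : ∀ k j → dv k (k ℕ.+ j) ≡ dv k j
  dv-shift k j with k ∣? (k ℕ.+ j) | k ∣? j
  ... | yes _ | yes _ = refl
  ... | no _ | no _ = refl
  ... | yes p | no ¬q = ⊥-elim (¬q (∣m+n∣m⇒∣n p ∣-refl))
  ... | no ¬p | yes q = ⊥-elim (¬p (∣m∣n⇒∣m+n ∣-refl q))

  Σ-multiples : ∀ k B (g : ℕ → ℤ) → 1 ≤ k → ΣZ (B ℕ.* k) (λ j → I (dv k (suc j)) (g (suc j))) ≡ ΣZ B (λ t → g (suc t ℕ.* k))
  Σ-multiples k zero g k≥1 = refl
  Σ-multiples k (suc B) g k≥1 = begin
    ΣZ (k ℕ.+ B ℕ.* k) f ≡⟨ ΣZ-split k (B ℕ.* k) f ⟩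
    ΣZ k f ℤ.+ ΣZ (B ℕ.* k) (λ j → f (k ℕ.+ j)) ≡⟨ cong₂ ℤ._+_ (first-multiple k g k≥1) (ΣZ-cong' (B ℕ.* k) shift) ⟩
    g k ℤ.+ ΣZ (B ℕ.* k) (λ j → I (dv k (suc j)) (g (k ℕ.+ suc j))) ≡⟨ cong (λ z → g k ℤ.+ z) (Σ-multiples k B (λ e → g (k ℕ.+ e)) k≥1) ⟩
    g k ℤ.+ ΣZ B (λ t → g (k ℕ.+ suc t ℕ.* k)) ≡⟨ cong (λ z → z ℤ.+ ΣZ B (λ t → g (k ℕ.+ suc t ℕ.* k))) (cong g (sym (ℕP.+-identityʳ k))) ⟩
    g (1 ℕ.* k) ℤ.+ ΣZ B (λ t → g (suc (suc t) ℕ.* k)) ≡⟨ sym (ΣZ-shift B (λ t → g (suc t ℕ.* k))) ⟩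
    ΣZ (suc B) (λ t → g (suc t ℕ.* k)) ∎
    where
    open ≡.≡-Reasoning
    f = λ j → I (dv k (suc j)) (g (suc j))
    shift : ∀ j → f (k ℕ.+ j) ≡ I (dv k (suc j)) (g (k ℕ.+ suc j))
    shift j = trans (cong (λ x → I (dv k x) (g x)) (sym (ℕP.+-suc k j))) (cong (λ b → I b (g (k ℕ.+ suc j))) (dv-shift k (suc j)))

  Σ-cofactor : ∀ a' m (h : ℕ → ℤ) → 1 ≤ m → ΣZ m (λ u → I (does (suc a' ℕ.* suc u ≟ m)) (h (suc u))) ≡ I (dv (suc a') m) (h (m / suc a'))
  Σ-cofactor a' m h m≥1 with suc a' ∣? m
  ... | no ¬d = trans (ΣZ-zero m (λ u _ → I-no (suc a' ℕ.* suc u ≟ m) _ (λ e → ¬d (divides (suc u) (trans (sym e) (ℕP.*-comm (suc a') (suc u))))))) (sym (I-no (suc a' ∣? m) _ ¬d))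
  ... | yes (divides zero refl) = ⊥-elim (ℕP.<-irrefl refl m≥1)
  ... | yes d@(divides (suc q') refl) = trans (ΣZ-delta m _ q' q'<m others) (trans (I-yes (suc a' ℕ.* suc q' ≟ suc q' ℕ.* suc a') _ (ℕP.*-comm (suc a') (suc q'))) (trans (cong h (sym (m*n/n≡m (suc q') (suc a')))) (sym (I-yes (suc a' ∣? m) _ d))))
    where
    q'<m : q' < suc q' ℕ.* suc a'
    q'<m = ℕP.<-≤-trans (ℕP.n<1+n q') (ℕP.m≤m*n (suc q') (suc a'))
    others : ∀ u → u < suc q' ℕ.* suc a' → ¬ (u ≡ q') → I (does (suc a' ℕ.* suc u ≟ suc q' ℕ.* suc a')) (h (suc u)) ≡ + 0
    others u _ u≢q = I-no (suc a' ℕ.* suc u ≟ suc q' ℕ.* suc a') _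
      (λ e → u≢q (ℕP.suc-injective (ℕP.*-cancelˡ-≡ (suc u) (suc q') (suc a') (trans e (ℕP.*-comm (suc q') (suc a'))))))

  -- d ↦ m / d permutes the divisors of m
  Σ-divisor-flip : ∀ m (h : ℕ → ℤ) → 1 ≤ m → ΣZ m (λ t → I (dv (suc t) m) (h (m / suc t))) ≡ ΣZ m (λ u → I (dv (suc u) m) (h (suc u)))
  Σ-divisor-flip m h m≥1 = begin
    ΣZ m (λ t → I (dv (suc t) m) (h (m / suc t))) ≡⟨ ΣZ-cong' m (λ t → sym (Σ-cofactor t m h m≥1)) ⟩
    ΣZ m (λ t → ΣZ m (λ u → I (does (suc t ℕ.* suc u ≟ m)) (h (suc u)))) ≡⟨ ΣZ-swap m m _ ⟩
    ΣZ m (λ u → ΣZ m (λ t → I (does (suc t ℕ.* suc u ≟ m)) (h (suc u)))) ≡⟨ ΣZ-cong' m inner ⟩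
    ΣZ m (λ u → I (dv (suc u) m) (h (suc u))) ∎
    where
    open ≡.≡-Reasoning
    inner : ∀ u → ΣZ m (λ t → I (does (suc t ℕ.* suc u ≟ m)) (h (suc u))) ≡ I (dv (suc u) m) (h (suc u))
    inner u = trans (ΣZ-cong' m (λ t → cong (λ x → I (does (x ≟ m)) (h (suc u))) (ℕP.*-comm (suc t) (suc u))))
                    (Σ-cofactor u m (λ _ → h (suc u)) m≥1)

  prime-divisor : ∀ m → 2 ≤ m → Σ ℕ (λ p → Prime p × p ∣ m)
  prime-divisor m m≥2 with factorise m ⦃ ℕ.>-nonZero (ℕP.<-trans (s≤s z≤n) m≥2) ⦄
  ... | record { factors = [] ; isFactorisation = e } = ⊥-elim (ℕP.<-irrefl (sym e) m≥2)
  ... | record { factors = p ∷ ps ; isFactorisation = e ; factorsPrime = pp ∷ _ } =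
    p , pp , subst (p ∣_) (sym e) (m∣m*n _)

  I-split : ∀ b c x → I b x ≡ I (b ∧ not c) x ℤ.+ I c (I b x)
  I-split true true x = sym (ℤP.+-identityˡ x)
  I-split true false x = sym (ℤP.+-identityʳ x)
  I-split false true x = refl
  I-split false false x = refl

  mobiusSum : ℕ → ℤ
  mobiusSum m = ΣZ m (λ u → I (dv (suc u) m) (μ (suc u)))

  coprimeMobiusSum : ℕ → ℕ → ℕ → ℤ
  coprimeMobiusSum p B M = ΣZ B (λ u → I (dv (suc u) M ∧ not (dv p (suc u))) (μ (suc u)))

  coprime-divisor-pred : ∀ {p m'} → Prime p → ∀ e → (dv e (m' ℕ.* p) ∧ not (dv p e)) ≡ (dv e m' ∧ not (dv p e))
  coprime-divisor-pred {p} {m'} pp e with p ∣? e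
  ... | yes _ = trans (BoolP.∧-zeroʳ _) (sym (BoolP.∧-zeroʳ _))
  ... | no p∤e with e ∣? (m' ℕ.* p) | e ∣? m'
  ...   | yes _ | yes _ = refl
  ...   | no _ | no _ = refl
  ...   | yes d | no ¬d = ⊥-elim (¬d (coprime-divisor (coprime-from-prime pp p∤e) (subst (e ∣_) (ℕP.*-comm m' p) d)))
  ...   | no ¬d | yes d = ⊥-elim (¬d (∣m⇒∣m*n p d))

  coprimeMobiusSum-shrink : ∀ {p} m' → Prime p → 1 ≤ m' → coprimeMobiusSum p (m' ℕ.* p) (m' ℕ.* p) ≡ coprimeMobiusSum p m' m'
  coprimeMobiusSum-shrink {p} m' pp m'≥1 = begin
    coprimeMobiusSum p (m' ℕ.* p) (m' ℕ.* p) ≡⟨ ΣZ-cong' (m' ℕ.* p) (λ u → cong (λ b → I b (μ (suc u))) (coprime-divisor-pred {m' = m'} pp (suc u))) ⟩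
    coprimeMobiusSum p (m' ℕ.* p) m' ≡⟨ cong (λ x → coprimeMobiusSum p x m') (sym eqR) ⟩
    coprimeMobiusSum p (m' ℕ.+ (m' ℕ.* p ℕ.∸ m')) m' ≡⟨ ΣZ-split m' _ _ ⟩
    coprimeMobiusSum p m' m' ℤ.+ ΣZ (m' ℕ.* p ℕ.∸ m') (λ j → I (dv (suc (m' ℕ.+ j)) m' ∧ not (dv p (suc (m' ℕ.+ j)))) (μ (suc (m' ℕ.+ j)))) ≡⟨ cong (λ z → coprimeMobiusSum p m' m' ℤ.+ z) (ΣZ-zero _ tail0) ⟩
    coprimeMobiusSum p m' m' ℤ.+ + 0 ≡⟨ ℤP.+-identityʳ _ ⟩
    coprimeMobiusSum p m' m' ∎
    where
    open ≡.≡-Reasoning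
    eqR : m' ℕ.+ (m' ℕ.* p ℕ.∸ m') ≡ m' ℕ.* p
    eqR = ℕP.m+[n∸m]≡n (ℕP.m≤m*n m' p ⦃ prime⇒nonZero pp ⦄)
    tail0 : ∀ j → j < m' ℕ.* p ℕ.∸ m' → I (dv (suc (m' ℕ.+ j)) m' ∧ not (dv p (suc (m' ℕ.+ j)))) (μ (suc (m' ℕ.+ j))) ≡ + 0
    tail0 j _ = I-∧-no (suc (m' ℕ.+ j) ∣? m') _ _ (λ d → ℕP.<-irrefl refl (ℕP.<-≤-trans (s≤s (ℕP.m≤m+n m' j)) (∣⇒≤ ⦃ ℕ.>-nonZero m'≥1 ⦄ d)))

  I-0 : ∀ b → I b (+ 0) ≡ + 0
  I-0 true = refl
  I-0 false = refl

  I-neg : ∀ b x → I b (ℤ.- x) ≡ ℤ.- I b x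
  I-neg true x = refl
  I-neg false x = refl

  dv-cancel : ∀ a b k → .{{NonZero k}} → dv (a ℕ.* k) (b ℕ.* k) ≡ dv a b
  dv-cancel a b k with (a ℕ.* k) ∣? (b ℕ.* k) | a ∣? b
  ... | yes _ | yes _ = refl
  ... | no _ | no _ = refl
  ... | yes d | no ¬d = ⊥-elim (¬d (*-cancelʳ-∣ k d))
  ... | no ¬d | yes d = ⊥-elim (¬d (*-monoˡ-∣ k d))

  μ-term-times-p : ∀ {p} m' t → Prime p → I (dv (suc t ℕ.* p) (m' ℕ.* p)) (μ (suc t ℕ.* p)) ≡ ℤ.- I (dv (suc t) m' ∧ not (dv p (suc t))) (μ (suc t))
  μ-term-times-p {p} m' t pp rewrite dv-cancel (suc t) m' p ⦃ prime⇒nonZero pp ⦄ with p ∣? suc t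
  ... | yes p∣st = trans (cong (I (dv (suc t) m')) (μ-sq pp (*-monoˡ-∣ p p∣st) st*p≥1)) 
                       (trans (I-0 _) (cong ℤ.-_ (sym (cong (λ b → I b (μ (suc t))) (BoolP.∧-zeroʳ (dv (suc t) m'))))))
    where
    st*p≥1 : 1 ≤ suc t ℕ.* p
    st*p≥1 = ℕP.*-mono-≤ {1} {suc t} {1} {p} (s≤s z≤n) (ℕP.<-trans (s≤s z≤n) (prime≥2 pp))
  ... | no p∤st = trans (cong (I (dv (suc t) m')) (trans (cong μ (ℕP.*-comm (suc t) p)) (μ-pg {g = suc t} pp p∤st (s≤s z≤n))))
                   (trans (I-neg (dv (suc t) m') (μ (suc t))) (cong (λ b → ℤ.- I b (μ (suc t))) (sym (BoolP.∧-identityʳ (dv (suc t) m')))))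

  -- Möbius' identity: pick a prime p ∣ m = m' p; the divisors of m are the
  -- divisors d of m' prime to p and their multiples d p, whose μ-terms cancel
  mobiusSum-zero : ∀ m → 2 ≤ m → mobiusSum m ≡ + 0
  mobiusSum-zero m m≥2 with prime-divisor m m≥2
  ... | p , pp , divides m' refl = begin
    mobiusSum (m' ℕ.* p) ≡⟨ ΣZ-cong' M (λ u → I-split (dv (suc u) M) (dv p (suc u)) (μ (suc u))) ⟩
    ΣZ M (λ u → I (dv (suc u) M ∧ not (dv p (suc u))) (μ (suc u)) ℤ.+ I (dv p (suc u)) (g (suc u))) ≡⟨ ΣZ-+ M _ _ ⟩
    coprimeMobiusSum p M M ℤ.+ ΣZ (m' ℕ.* p) (λ u → I (dv p (suc u)) (g (suc u))) ≡⟨ cong₂ ℤ._+_ (coprimeMobiusSum-shrink m' pp m'≥1) (Σ-multiples p m' g p≥1) ⟩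
    coprimeMobiusSum p m' m' ℤ.+ ΣZ m' (λ t → g (suc t ℕ.* p)) ≡⟨ cong (λ z → coprimeMobiusSum p m' m' ℤ.+ z) (trans (ΣZ-cong' m' (λ t → μ-term-times-p m' t pp)) (sym (ΣZ-neg m' _))) ⟩
    coprimeMobiusSum p m' m' ℤ.+ ℤ.- coprimeMobiusSum p m' m' ≡⟨ ℤP.+-inverseʳ (coprimeMobiusSum p m' m') ⟩
    + 0 ∎
    where
    open ≡.≡-Reasoning
    M = m' ℕ.* p
    g = λ e → I (dv e M) (μ e)
    p≥1 : 1 ≤ p
    p≥1 = ℕP.<-trans (s≤s z≤n) (prime≥2 pp)
    m'≥1 : 1 ≤ m'
    m'≥1 = cofactor≥1 m' m≥2
      where
      cofactor≥1 : ∀ x → 2 ≤ x ℕ.* p → 1 ≤ x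
      cofactor≥1 zero ()
      cofactor≥1 (suc _) _ = s≤s z≤n

  -- m / e, defined for every e (the Ramanujan sum only uses e ≥ 1)
  quot : ℕ → ℕ → ℕ
  quot n zero = 0
  quot n (suc e) = n / suc e

  I-∧ : ∀ a b x → I (a ∧ b) x ≡ I b (I a x)
  I-∧ true true x = refl
  I-∧ true false x = refl
  I-∧ false true x = refl
  I-∧ false false x = refl

  -- for k ∣ n, k < n:  Σ_{e ∣ n, k ∣ e} μ(n/e) = Σ_{t ∣ n/k} μ((n/k)/t) = 0
  Σ-μ-multiples-of : ∀ n k → 1 ≤ k → k ∣ n → k < n → ΣZ n (λ j → I (dv (suc j) n ∧ dv k (suc j)) (μ (n / suc j))) ≡ + 0
  Σ-μ-multiples-of n (suc k') _ (divides m refl) k<n = begin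
    ΣZ (m ℕ.* k) (λ j → I (dv (suc j) N ∧ dv k (suc j)) (μ (N / suc j))) ≡⟨ ΣZ-cong' N (λ j → I-∧ (dv (suc j) N) (dv k (suc j)) _) ⟩
    ΣZ (m ℕ.* k) (λ j → I (dv k (suc j)) (g (suc j))) ≡⟨ Σ-multiples k m g (s≤s z≤n) ⟩
    ΣZ m (λ t → g (suc t ℕ.* k)) ≡⟨ ΣZ-cong' m term-at-multiple ⟩
    ΣZ m (λ t → I (dv (suc t) m) (μ (m / suc t))) ≡⟨ Σ-divisor-flip m μ m≥1 ⟩
    mobiusSum m ≡⟨ mobiusSum-zero m m≥2 ⟩
    + 0 ∎
    where
    open ≡.≡-Reasoning
    k = suc k'
    N = m ℕ.* k
    g = λ e → I (dv e N) (μ (quot N e))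
    term-at-multiple : ∀ t → g (suc t ℕ.* k) ≡ I (dv (suc t) m) (μ (m / suc t))
    term-at-multiple t = cong₂ (λ b x → I b (μ x)) (dv-cancel (suc t) m k) (m*n/o*n≡m/o m k (suc t))
    m≥2 : 2 ≤ m
    m≥2 = cofactor≥2 m k<n
      where
      cofactor≥2 : ∀ x → k < x ℕ.* k → 2 ≤ x
      cofactor≥2 zero ()
      cofactor≥2 (suc zero) lt = ⊥-elim (ℕP.<-irrefl (sym (ℕP.+-identityʳ k)) lt)
      cofactor≥2 (suc (suc x)) _ = s≤s (s≤s z≤n)
    m≥1 : 1 ≤ m
    m≥1 = ℕP.<-trans (s≤s z≤n) m≥2

module RationalAlgebra {c ℓ} (K : CommutativeRing c ℓ) (f : ℚ → CommutativeRing.Carrier K) (hom : IsℚAlgebraMap K f) where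
  open import Data.Nat using (zero; suc)
  open import Data.Integer as ℤ using (ℤ; +_; -[1+_])
  import Data.Integer.Properties as ℤP
  open import Data.Rational using (mkℚ)
  import Data.Rational.Base as ℚB
  import Data.Rational.Properties as ℚP
  import Data.Nat.Coprimality as Coprimality
  open import Data.Product using (Σ; _,_)
  open import Relation.Binary.PropositionalEquality as ≡ using (_≡_)
  open import Algebra.Morphism.Structures using (module RingMorphisms)
  open CommutativeRing K
  open Poly K using (ιℤ)
  open IntegerSolver K using (nat; int)
  open RingMorphisms ℚB.+-*-rawRing rawRing
  open IsRingHomomorphism hom
  open import Relation.Binary.Reasoning.Setoid setoid

  private
    f-≡ : ∀ {p q} → p ≡ q → f p ≈ f q
    f-≡ ≡.refl = refl

    n/1≡ : ∀ n → (+ n) ℚB./ 1 ≡ mkℚ (+ n) 0 (Coprimality.sym (Coprimality.1-coprimeTo n))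
    n/1≡ n = ℚP.normalize-coprime (Coprimality.sym (Coprimality.1-coprimeTo n))

    suc/1≡ : ∀ n → (+ suc n) ℚB./ 1 ≡ ((+ 1) ℚB./ 1) ℚB.+ ((+ n) ℚB./ 1)
    suc/1≡ n = ≡.sym (≡.trans (≡.cong₂ ℚB._+_ (n/1≡ 1) (n/1≡ n)) (≡.cong (λ z → z ℚB./ 1) numerator))
      where
      numerator : (+ 1) ℤ.* (+ 1) ℤ.+ (+ n) ℤ.* (+ 1) ≡ + suc n
      numerator = ≡.cong (λ z → (+ 1) ℤ.+ z) (ℤP.*-identityʳ (+ n))

  ι-nat : ∀ n → ιℤ f (+ n) ≈ nat n
  ι-nat zero = 0#-homo
  ι-nat (suc n) = begin
    f ((+ suc n) ℚB./ 1)                          ≈⟨ f-≡ (suc/1≡ n) ⟩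
    f (((+ 1) ℚB./ 1) ℚB.+ ((+ n) ℚB./ 1))        ≈⟨ +-homo _ _ ⟩
    f ((+ 1) ℚB./ 1) + f ((+ n) ℚB./ 1)            ≈⟨ +-cong 1#-homo (ι-nat n) ⟩
    1# + nat n                                     ∎

  ι-int : ∀ z → ιℤ f z ≈ int z
  ι-int (+ n) = ι-nat n
  ι-int -[1+ n ] = trans (-‿homo ((+ suc n) ℚB./ 1)) (-‿cong (ι-nat (suc n)))

  inverse-of-nat : ∀ n → f ((+ 1) ℚB./ suc n) * nat (suc n) ≈ 1#
  inverse-of-nat n = begin
    f ((+ 1) ℚB./ suc n) * nat (suc n)                 ≈⟨ *-congˡ (sym (ι-nat (suc n))) ⟩
    f ((+ 1) ℚB./ suc n) * f ((+ suc n) ℚB./ 1)        ≈⟨ sym (*-homo _ _) ⟩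
    f (((+ 1) ℚB./ suc n) ℚB.* ((+ suc n) ℚB./ 1))     ≈⟨ f-≡ product≡1 ⟩
    f ℚB.1ℚ                                            ≈⟨ 1#-homo ⟩
    1#                                                 ∎
    where
    product≡1 : ((+ 1) ℚB./ suc n) ℚB.* ((+ suc n) ℚB./ 1) ≡ ℚB.1ℚ
    product≡1 = ≡.trans (≡.cong₂ ℚB._*_ (ℚP.normalize-coprime (Coprimality.1-coprimeTo (suc n))) (n/1≡ (suc n)))
                        (ℚP.*-inverseˡ (mkℚ (+ suc n) 0 (Coprimality.sym (Coprimality.1-coprimeTo (suc n)))))

  inverses : ∀ b → 1 ≤ b → Σ Carrier (λ y → y * nat b ≈ 1#)
  inverses (suc b) _ = f ((+ 1) ℚB./ suc b) , inverse-of-nat b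

module RamanujanSums where
  open import Data.Nat as ℕ using (suc)
  open import Data.Nat.Divisibility using (_∣?_)
  open import Data.Integer as ℤ using (ℤ; +_; ∣_∣)
  import Data.Integer.Properties as ℤP
  import Data.Integer.Divisibility.Signed as ℤD
  open import Data.Bool using (_∧_; if_then_else_)
  open import Relation.Binary.PropositionalEquality as ≡ using (_≡_)
  open import Relation.Nullary using (yes; no; does; Dec)
  open import Data.Empty using (⊥-elim)
  open MobiusSums using (ΣZ)

  -- the term of the divisor e = k + 1
  ramanujanTerm : ℕ → ℤ → ℕ → ℤ
  ramanujanTerm n l k = if does (suc k ∣? n) ∧ does (suc k ∣? ∣ l ∣) then μ (n ℕ./ suc k) ℤ.* (+ suc k) else + 0

  ramanujan-Σ : ∀ n l → ramanujan n l ≡ ΣZ n (ramanujanTerm n l)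
  ramanujan-Σ n l = FiniteSums.foldr-map-applyUpTo ℤP.+-*-commutativeRing n (ramanujanTerm n l) (λ x → x)

  ∣-shift : ∀ e l n → e ∣ n → does (e ∣? ∣ l ℤ.+ + n ∣) ≡ does (e ∣? ∣ l ∣)
  ∣-shift e l n e∣n with e ∣? ∣ l ℤ.+ + n ∣ | e ∣? ∣ l ∣
  ... | yes _ | yes _ = ≡.refl
  ... | no _ | no _ = ≡.refl
  ... | yes p | no ¬q = ⊥-elim (¬q (ℤD.∣⇒∣ᵤ {+ e} {l} (ℤD.∣m+n∣n⇒∣m {+ e} {l} {+ n} (ℤD.∣ᵤ⇒∣ {+ e} {l ℤ.+ + n} p) (ℤD.∣ᵤ⇒∣ {+ e} {+ n} e∣n))))
  ... | no ¬p | yes q = ⊥-elim (¬p (ℤD.∣⇒∣ᵤ {+ e} {l ℤ.+ + n} (ℤD.∣m∣n⇒∣m+n {+ e} {l} {+ n} (ℤD.∣ᵤ⇒∣ {+ e} {l} q) (ℤD.∣ᵤ⇒∣ {+ e} {+ n} e∣n))))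

  ramanujanTerm-periodic : ∀ n l k → ramanujanTerm n (l ℤ.+ + n) k ≡ ramanujanTerm n l k
  ramanujanTerm-periodic n l k = by-cases (suc k ∣? n)
    where
    term = μ (n ℕ./ suc k) ℤ.* (+ suc k)
    by-cases : (d : Dec (suc k ∣ n)) → (if does d ∧ does (suc k ∣? ∣ l ℤ.+ + n ∣) then term else + 0)
                                     ≡ (if does d ∧ does (suc k ∣? ∣ l ∣) then term else + 0)
    by-cases (no _) = ≡.refl
    by-cases (yes d) = ≡.cong (λ b → if b then term else + 0) (∣-shift (suc k) l n d)

  ramanujan-periodic : ∀ n l → ramanujan n (l ℤ.+ + n) ≡ ramanujan n l
  ramanujan-periodic n l = ≡.trans (ramanujan-Σ n (l ℤ.+ + n))
    (≡.trans (FiniteSums.Σ-cong' ℤP.+-*-commutativeRing n (ramanujanTerm-periodic n l)) (≡.sym (ramanujan-Σ n l)))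

  suc-minus-suc : ∀ i s → + suc i ℤ.- + suc s ≡ + i ℤ.- + s
  suc-minus-suc i s = ≡.trans (ℤP.m-n≡m⊖n (suc i) (suc s)) (≡.trans (ℤP.[1+m]⊖[1+n]≡m⊖n i s) (≡.sym (ℤP.m-n≡m⊖n i s)))

  wrap-around : ∀ n' s → (+ 0 ℤ.- + suc s) ℤ.+ + suc n' ≡ + n' ℤ.- + s
  wrap-around n' s = ≡.trans (ℤP.[1+m]⊖[1+n]≡m⊖n n' s) (≡.sym (ℤP.m-n≡m⊖n n' s))

module RamanujanWindows {c ℓ} (K : CommutativeRing c ℓ) (n' : ℕ) where
  open import Data.Nat using (zero; suc)
  open import Data.Integer as ℤ using (+_)
  open import Relation.Binary.PropositionalEquality as ≡ using (_≡_)
  open import Function using (_∘′_)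
  open CommutativeRing K hiding (zero)
  open Poly K
  open PolynomialRing K
  open PolynomialDivisibility K
  open PolynomialFacts K
  open PolynomialExpansions K
  open RamanujanSums using (ramanujan-periodic; suc-minus-suc; wrap-around)
  open IntegerSolver K using (int)

  n : ℕ
  n = suc n'

  window : ℕ → ℕ → Carrier
  window s i = int (ramanujan n (+ i ℤ.- + s))

  W : ℕ → Pol
  W s = mkP n (window s)

  T : Pol
  T = W 0

  -- by n-periodicity of c_n, the window of s + 1 is that of s rotated
  W-suc : ∀ s → W (suc s) ≋ mkP n (rotate n' (window s))
  W-suc s = mk-cong n λ
    { zero _ → reflexive (≡.cong int (≡.trans (≡.sym (ramanujan-periodic n (+ 0 ℤ.- + suc s)))
                                              (≡.cong (ramanujan n) (wrap-around n' s))))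
    ; (suc i) _ → reflexive (≡.cong (int ∘′ ramanujan n) (suc-minus-suc i s)) }

  W≡xˢT : ∀ s → W s ≡ (xPow s *ₚ T) [mod xm1 n ]
  W≡xˢT zero = ≋⇒≡ (≋-sym (*-identityˡₚ T))
  W≡xˢT (suc s) = ≡-≋ˡ (≋-sym (W-suc s)) (≡-trans (rotate-≡-X n' (window s))
    (≡-≋ˡ (≋-sym (X≋x* (W s))) (≡-≋ʳ xxˢT≈xˢ⁺¹T (≡-*ˡ (xPow 1) (W≡xˢT s)))))
    where
    xxˢT≈xˢ⁺¹T : (xPow 1 *ₚ (xPow s *ₚ T)) ≋ (xPow (suc s) *ₚ T)
    xxˢT≈xˢ⁺¹T = ≋-trans (≋-sym (*-assocₚ (xPow 1) (xPow s) T)) (*-congˡₚ T (≋-sym (xPow-+ 1 s)))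

module GModuloXn {c ℓ} (K : CommutativeRing c ℓ) (f : ℚ → CommutativeRing.Carrier K) (hom : IsℚAlgebraMap K f) (n' : ℕ) where
  import Data.Nat as ℕ
  import Data.Nat.Properties as ℕP
  open import Data.Integer as ℤ using (+_)
  import Data.Rational.Base as ℚB
  open import Data.List using (length)
  open import Relation.Nullary using (yes; no)
  open CommutativeRing K hiding (zero)
  open Poly K
  open PolynomialRing K
  open PolynomialDivisibility K
  open PolynomialFacts K
  open PolynomialExpansions K
  open RationalAlgebra K f hom using (ι-int)
  open RamanujanWindows K n'

  ν : Carrier
  ν = f (ℚB._/_ (+ 1) n)

  G-as-sum : ∀ a → G f n a ≋ (cst ν *ₚ ΣP (length a) (λ s → cst (coeff a s) *ₚ W s))
  G-as-sum a = mk λ i → trans (coeffwise i) (sym (trans (coeff-cst* ν (ΣP L term) i) (*-congˡ (coeff-Σ L term i))))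
    where
    L = length a
    term = λ s → cst (coeff a s) *ₚ W s
    coeffwise : ∀ i → coeff (G f n a) i ≈ ν * ΣK L (λ s → coeff (term s) i)
    coeffwise i with i ℕ.<? n
    ... | yes i<n = trans (reflexive (coeff-mk-lt n _ i i<n))
          (*-congˡ (trans (foldrK-map-applyUpTo L _ (λ x → x))
            (ΣK-cong' L (λ s → sym (trans (coeff-cst* (coeff a s) (W s) i)
              (*-congˡ (trans (reflexive (coeff-mk-lt n _ i i<n)) (sym (ι-int (ramanujan n (+ i ℤ.- + s)))))))))))
    ... | no i≮n = trans (reflexive (coeff-mk-ge n _ i (ℕP.≮⇒≥ i≮n)))
          (sym (trans (*-congˡ (ΣK-zero L (λ s _ → trans (coeff-cst* (coeff a s) (W s) i)
            (trans (*-congˡ (reflexive (coeff-mk-ge n _ i (ℕP.≮⇒≥ i≮n)))) (zeroʳ _))))) (zeroʳ ν)))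

  G≡νaT : ∀ a → G f n a ≡ (cst ν *ₚ (a *ₚ T)) [mod xm1 n ]
  G≡νaT a = ≡-≋ˡ (≋-sym (G-as-sum a)) (≡-*ˡ (cst ν) (≡-≋ʳ sum≈aT (ΣP-mod L _ _ (λ s _ → ≡-*ˡ (cst (coeff a s)) (W≡xˢT s)))))
    where
    L = length a
    sum≈aT : ΣP L (λ s → cst (coeff a s) *ₚ (xPow s *ₚ T)) ≋ (a *ₚ T)
    sum≈aT = ≋-trans (ΣP-cong' L (λ s → ≋-sym (*-assocₚ (cst (coeff a s)) (xPow s) T)))
               (≋-trans (≋-sym (ΣP-*ʳ L T (λ s → cst (coeff a s) *ₚ xPow s))) (*-congˡₚ T (≋-sym (monomial-expansion a))))

module TModuloCyclotomic {c ℓ} (K : CommutativeRing c ℓ) (Φ : ℕ → Poly.Pol K) (cyc : Poly.IsCyclotomicFamily K Φ) (n' : ℕ) where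
  open import Data.Nat as ℕ using (zero; suc; z≤n; s≤s)
  import Data.Nat.Properties as ℕP
  open import Data.Nat.Divisibility using (_∣?_; divides; ∣-refl; ∣-reflexive; ∣⇒≤)
  open import Data.Nat.DivMod using (n/n≡1)
  open import Data.Integer as ℤ using (ℤ; +_)
  import Data.Integer.Properties as ℤP
  open import Data.Bool using (_∧_; if_then_else_)
  open import Data.List using ([])
  open import Relation.Binary.PropositionalEquality as ≡ using (_≡_; _≢_)
  open import Relation.Nullary using (¬_; yes; no; does; Dec)
  open import Function using (_∘_)
  open CommutativeRing K hiding (zero)
  open Poly K
  open PolynomialRing K
  open PolynomialDivisibility K
  open PolynomialFacts K
  open PolynomialExpansions K using (ΣP-single-mod)
  open GeometricSums K
  open CyclotomicFacts K Φ cyc using (Φ∣xm1; Φ∣geomSum)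
  open MobiusSums using (ΣZ; I; dv; I-yes; Σ-μ-multiples-of)
  open RamanujanSums using (ramanujanTerm; ramanujan-Σ)
  open RamanujanWindows K n'
  open IntegerSolver K using (int; int-+; int-*; nat; nat-*)

  int-Σ : ∀ m (g : ℕ → ℤ) → int (ΣZ m g) ≈ ΣK m (int ∘ g)
  int-Σ zero g = refl
  int-Σ (suc m) g = trans (int-+ (ΣZ m g) (g m)) (+-congʳ (int-Σ m g))

  divisorWindow : ℕ → Pol
  divisorWindow e = mkP n (divInd e)

  divisorWindow≈geomSum : ∀ e m → n ≡ m ℕ.* e → divisorWindow e ≋ geomSum e m
  divisorWindow≈geomSum e m eq = ≡.subst (λ x → mkP x (divInd e) ≋ geomSum e m) (≡.sym eq) ≋-refl

  coefficientOf : ℕ → ℤ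
  coefficientOf j = I (dv (suc j) n) (μ (n ℕ./ suc j) ℤ.* + suc j)

  term : ℕ → Pol
  term j = cst (int (coefficientOf j)) *ₚ divisorWindow (suc j)

  T-expand : T ≋ ΣP n term
  T-expand = mk λ i → trans (coeffwise i) (sym (coeff-Σ n term i))
    where
    pointwise : ∀ i j → i < n → int (ramanujanTerm n (+ i) j) ≈ coeff (term j) i
    pointwise i j i<n = trans (by-cases (suc j ∣? n) (suc j ∣? i)) (sym (coeff-cst* (int (coefficientOf j)) (divisorWindow (suc j)) i))
      where
      value = μ (n ℕ./ suc j) ℤ.* + suc j
      window-i : coeff (divisorWindow (suc j)) i ≡ divInd (suc j) i
      window-i = coeff-mk-lt n (divInd (suc j)) i i<n
      by-cases : (d₁ : Dec (suc j ∣ n)) (d₂ : Dec (suc j ∣ i)) →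
                 int (if does d₁ ∧ does d₂ then value else + 0) ≈ int (I (does d₁) value) * coeff (divisorWindow (suc j)) i
      by-cases (yes _) (yes d) = trans (sym (*-identityʳ _)) (*-congˡ (sym (trans (reflexive window-i) (divInd-yes d))))
      by-cases (yes _) (no ¬d) = sym (trans (*-congˡ (trans (reflexive window-i) (divInd-no ¬d))) (zeroʳ _))
      by-cases (no _) d₂ = sym (zeroˡ _)
    coeffwise : ∀ i → coeff T i ≈ ΣK n (λ j → coeff (term j) i)
    coeffwise i with i ℕ.<? n
    ... | yes i<n = trans (reflexive (coeff-mk-lt n _ i i<n))
                    (trans (reflexive (≡.cong (λ l → int (ramanujan n l)) (ℤP.+-identityʳ (+ i))))
                    (trans (reflexive (≡.cong int (ramanujan-Σ n (+ i))))
                    (trans (int-Σ n (ramanujanTerm n (+ i))) (ΣK-cong' n (λ j → pointwise i j i<n)))))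
    ... | no i≮n = trans (reflexive (coeff-mk-ge n _ i (ℕP.≮⇒≥ i≮n)))
                   (sym (ΣK-zero n (λ j _ → trans (coeff-cst* (int (coefficientOf j)) (divisorWindow (suc j)) i)
                     (trans (*-congˡ (reflexive (coeff-mk-ge n (divInd (suc j)) i (ℕP.≮⇒≥ i≮n)))) (zeroʳ _)))))

  private
    cofactor≥1 : ∀ m e → n ≡ m ℕ.* e → 1 ≤ m
    cofactor≥1 zero e ()
    cofactor≥1 (suc m) e _ = s≤s z≤n

  -- for e ∣ n, e < n, Φ_n divides P_e(n/e)
  term≡0-mod-Φn : ∀ j → j < n → j ≢ n' → term j ≡ [] [mod Φ n ]
  term≡0-mod-Φn j j<n j≢n' = by-cases (suc j ∣? n)
    where
    value = μ (n ℕ./ suc j) ℤ.* + suc j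
    n∤j+1 : ¬ (n ∣ suc j)
    n∤j+1 d = ℕP.<-irrefl ≡.refl (ℕP.<-≤-trans (s≤s (ℕP.≤∧≢⇒< (ℕP.≤-pred j<n) j≢n')) (∣⇒≤ d))
    by-cases : (d : Dec (suc j ∣ n)) → (cst (int (I (does d) value)) *ₚ divisorWindow (suc j)) ≡ [] [mod Φ n ]
    by-cases (no _) = ≋⇒≡ (≋-trans (*-congˡₚ (divisorWindow (suc j)) cst-0) (zero-* [] (divisorWindow (suc j)) (λ _ → refl)))
    by-cases (yes (divides m eq)) = ∣⇒≡0 (∣'-* (cst (int value)) (∣'-cong (≋-sym (divisorWindow≈geomSum (suc j) m eq))
      (Φ∣geomSum (suc j) m n (s≤s z≤n) (cofactor≥1 m (suc j) eq) (s≤s z≤n) (∣-reflexive eq) n∤j+1)))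

  -- only the term e = n survives modulo Φ_n, and it equals n
  T≡n : T ≡ cst (nat n) [mod Φ n ]
  T≡n = ≡-≋ˡ (≋-sym T-expand) (≡-≋ʳ last-term (ΣP-single-mod n term n' ℕP.≤-refl term≡0-mod-Φn))
    where
    coefficient-n : coefficientOf n' ≡ + n
    coefficient-n = ≡.trans (I-yes (n ∣? n) _ ∣-refl) (≡.trans (≡.cong (λ x → μ x ℤ.* + n) (n/n≡1 n)) (ℤP.*-identityˡ (+ n)))
    last-term : term n' ≋ cst (nat n)
    last-term = ≋-trans (*-congₚ (cst-cong (reflexive (≡.cong int coefficient-n))) (first-block n (s≤s z≤n))) (*-identityʳₚ (cst (nat n)))

  -- modulo Φ_k (k ∣ n, k < n) the term of e = j + 1 reduces to [k ∣ e] μ(n/e) n: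
  -- P_e(n/e) ≡ n/e when k ∣ e, and Φ_k ∣ P_e(n/e) otherwise
  μ-term : ℕ → ℕ → ℤ
  μ-term k j = I (dv (suc j) n ∧ dv k (suc j)) (μ (n ℕ./ suc j))

  reducedTerm : ℕ → ℕ → Pol
  reducedTerm k j = cst (int (μ-term k j) * nat n)

  term≡reduced : ∀ k → 1 ≤ k → k ∣ n → ∀ j → term j ≡ reducedTerm k j [mod Φ k ]
  term≡reduced k k≥1 k∣n j = by-cases (suc j ∣? n) (k ∣? suc j)
    where
    μ' = μ (n ℕ./ suc j)
    value = μ' ℤ.* + suc j
    by-cases : (d₁ : Dec (suc j ∣ n)) (d₂ : Dec (k ∣ suc j)) →
               (cst (int (I (does d₁) value)) *ₚ divisorWindow (suc j)) ≡ cst (int (I (does d₁ ∧ does d₂) μ') * nat n) [mod Φ k ]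
    by-cases (no _) d₂ = ≋⇒≡ (≋-trans (*-congˡₚ (divisorWindow (suc j)) cst-0)
      (≋-trans (zero-* [] (divisorWindow (suc j)) (λ _ → refl)) (≋-sym (≋-trans (cst-cong (zeroˡ _)) cst-0))))
    by-cases (yes (divides m eq)) (yes k∣e) =
      ≡-≋ʳ (≋-trans (≋-sym (cst-mul (int value) (nat m))) (cst-cong value·m≈μ'·n))
        (≡-*ˡ (cst (int value)) (≡-≋ˡ (≋-sym (divisorWindow≈geomSum (suc j) m eq))
          (≡-weaken (Φ∣xm1 k≥1 (s≤s z≤n) k∣e) (geomSum-mod (suc j) m (s≤s z≤n)))))
      where
      open import Relation.Binary.Reasoning.Setoid setoid
      value·m≈μ'·n : int value * nat m ≈ int μ' * nat n
      value·m≈μ'·n = begin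
        int value * nat m                 ≈⟨ *-congʳ (int-* μ' (+ suc j)) ⟩
        (int μ' * nat (suc j)) * nat m    ≈⟨ *-assoc _ _ _ ⟩
        int μ' * (nat (suc j) * nat m)    ≈⟨ *-congˡ (sym (nat-* (suc j) m)) ⟩
        int μ' * nat (suc j ℕ.* m)        ≡⟨ ≡.cong (λ x → int μ' * nat x) (≡.trans (ℕP.*-comm (suc j) m) (≡.sym eq)) ⟩
        int μ' * nat n                    ∎
    by-cases (yes (divides m eq)) (no k∤e) =
      ≡-≋ʳ (≋-sym (≋-trans (cst-cong (zeroˡ _)) cst-0))
        (∣⇒≡0 (∣'-* (cst (int value)) (∣'-cong (≋-sym (divisorWindow≈geomSum (suc j) m eq))
          (Φ∣geomSum (suc j) m k (s≤s z≤n) (cofactor≥1 m (suc j) eq) k≥1 (≡.subst (k ∣_) eq k∣n) k∤e))))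

  -- hence T ≡ n Σ_{e ∣ n, k ∣ e} μ(n/e) = 0 (mod Φ_k)
  T≡0 : ∀ k → 1 ≤ k → k ∣ n → k < n → T ≡ [] [mod Φ k ]
  T≡0 k k≥1 k∣n k<n = ≡-≋ˡ (≋-sym T-expand) (≡-≋ʳ sum≈0 (ΣP-mod n term (reducedTerm k) (λ j _ → term≡reduced k k≥1 k∣n j)))
    where
    sum≈0 : ΣP n (reducedTerm k) ≋ []
    sum≈0 = ≋-trans (ΣP-cst n (λ j → int (μ-term k j) * nat n))
      (≋-trans (cst-cong (trans (sym (ΣK-*ʳ n (nat n) (int ∘ μ-term k))) (trans (*-congʳ (sym (int-Σ n (μ-term k))))
        (trans (*-congʳ (reflexive (≡.cong int (Σ-μ-multiples-of n k k≥1 k∣n k<n)))) (zeroˡ _))))) cst-0)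

module CharacterisationOfG {c ℓ} (K : CommutativeRing c ℓ) (f : ℚ → CommutativeRing.Carrier K) (hom : IsℚAlgebraMap K f)
                           (Φ : ℕ → Poly.Pol K) (cyc : Poly.IsCyclotomicFamily K Φ) (n' : ℕ) where
  open import Data.Nat as ℕ using (z≤n; s≤s)
  import Data.Nat.Properties as ℕP
  open import Data.Nat.Divisibility using (∣-trans; ∣-refl; ∣⇒≤)
  open import Data.List using ([])
  open import Data.Product using () renaming (_,_ to _,,_)
  open import Relation.Binary.PropositionalEquality as ≡ using (_≡_)
  open import Relation.Nullary using (yes; no)
  open CommutativeRing K hiding (zero)
  open Poly K
  open PolynomialRing K
  open PolynomialDivisibility K
  open PolynomialFacts K
  open RationalAlgebra K f hom using (inverse-of-nat; inverses)
  open CyclotomicFacts K Φ cyc using (Φ∣xm1; xm1-∣)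
  open RamanujanWindows K n' using (n; T)
  open GModuloXn K f hom n' using (ν; G≡νaT)
  open TModuloCyclotomic K Φ cyc n' using (T≡n; T≡0)
  open IntegerSolver K using (nat)
  open import Algebra.Properties.Ring ring using (-0#≈0#)

  toCongruent : ∀ {A B M} → A ≡ B [mod M ] → Congruent A B M
  toCongruent (cg (q , e)) = q ,, get e

  fromCongruent : ∀ {A B M} → Congruent A B M → A ≡ B [mod M ]
  fromCongruent (q ,, e) = cg (q , mk e)

  Gₙ : Pol → Pol
  Gₙ = G f n

  -- modulo Φ_n:  G ≡ ν a T ≡ ν a n = a
  G≡a : ∀ a → Gₙ a ≡ a [mod Φ n ]
  G≡a a = ≡-trans (≡-weaken (Φ∣xm1 (s≤s z≤n) (s≤s z≤n) ∣-refl) (G≡νaT a)) (≡-≋ʳ ν·a·n≈a (≡-*ˡ (cst ν) (≡-*ˡ a T≡n)))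
    where
    open IntegerSolver PolRing using (solve; _:*_; _:=_)
    ν·a·n≈a : (cst ν *ₚ (a *ₚ cst (nat n))) ≋ a
    ν·a·n≈a = ≋-trans (solve 3 (λ v a N → v :* (a :* N) := a :* (v :* N)) ≋-refl (cst ν) a (cst (nat n)))
      (≋-trans (*-congʳₚ a (≋-trans (≋-sym (cst-mul ν (nat n))) (cst-cong (inverse-of-nat n')))) (*-identityʳₚ a))

  -- modulo Φ_k, k a proper divisor of n:  G ≡ ν a T ≡ 0
  Φ∣G : ∀ a k → 1 ≤ k → k ∣ n → k < n → Φ k ∣' Gₙ a
  Φ∣G a k k≥1 k∣n k<n = ≡0⇒∣ (≡-trans (≡-weaken (Φ∣xm1 k≥1 (s≤s z≤n) k∣n) (G≡νaT a))
    (≡-≋ʳ (≋-trans (*-congʳₚ (cst ν) (*-zeroʳₚ a)) (*-zeroʳₚ (cst ν))) (≡-*ˡ (cst ν) (≡-*ˡ a (T≡0 k k≥1 k∣n k<n)))))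

  G-degree : ∀ a → DegLt (Gₙ a) n
  G-degree a s n≤s = reflexive (coeff-mk-ge n _ s n≤s)

  -- x^d - 1 = Π_{k ∣ d} Φ_k divides G for every proper divisor d of n
  G-vanishes : ∀ a d → 1 ≤ d → d < n → d ∣ n → Congruent (Gₙ a) zeroₚ (xm1 d)
  G-vanishes a d d≥1 d<n d∣n = toCongruent (∣⇒≡0 (xm1-∣ inverses d (Gₙ a) d≥1 (λ k k≥1 k∣d →
    Φ∣G a k k≥1 (∣-trans k∣d d∣n) (ℕP.≤-<-trans (∣⇒≤ ⦃ ℕ.>-nonZero d≥1 ⦄ k∣d) d<n))))

  -- b - G is divisible by every Φ_k (k ∣ n), hence by x^n - 1, and has
  -- degree < n, so it vanishes
  G-unique : ∀ a b → DegLt b n → Congruent b a (Φ n) → (∀ d → 1 ≤ d → d < n → d ∣ n → Congruent b zeroₚ (xm1 d)) → b ≈ₚ Gₙ a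
  G-unique a b deg-b b≡a b-vanishes s = x-y≈0⇒x≈y (trans (sym (coeff-- b (Gₙ a) s)) (get difference≈0 s))
    where
    Φ∣difference : ∀ k → 1 ≤ k → k ∣ n → Φ k ∣' (b -ₚ Gₙ a)
    Φ∣difference k k≥1 k∣n with k ℕ.<? n
    ... | yes k<n = ∣'-+ (∣'-trans (Φ∣xm1 k≥1 k≥1 ∣-refl) (≡0⇒∣ (fromCongruent (b-vanishes k k≥1 k<n k∣n))))
                         (∣'-neg (Φ∣G a k k≥1 k∣n k<n))
    ... | no k≮n with ℕP.≤-antisym (∣⇒≤ k∣n) (ℕP.≮⇒≥ k≮n)
    ...   | ≡.refl = getcg (≡-trans (fromCongruent b≡a) (≡-sym (G≡a a)))
    deg-difference : DegLt (b -ₚ Gₙ a) n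
    deg-difference s n≤s = trans (coeff-- b (Gₙ a) s)
      (trans (+-cong (deg-b s n≤s) (trans (-‿cong (G-degree a s n≤s)) -0#≈0#)) (+-identityʳ 0#))
    difference≈0 : (b -ₚ Gₙ a) ≋ []
    difference≈0 = deg-lemma n (b -ₚ Gₙ a) (s≤s z≤n) deg-difference (xm1-∣ inverses n (b -ₚ Gₙ a) (s≤s z≤n) Φ∣difference)

open import Data.Nat using (suc)
open import Data.Product using (_,_)

theorem3p8 : {c ℓ : Level} (K : CommutativeRing c ℓ) (f : ℚ → CommutativeRing.Carrier K) →
    IsℚAlgebraMap K f →
    let open Poly K in
    (Φ : ℕ → Pol) → IsCyclotomicFamily Φ →
    (n : ℕ) .{{_ : NonZero n}} (a : Pol) →
      (DegLt (G f n a) n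
        × Congruent (G f n a) a (Φ n)
        × (∀ d → 1 ≤ d → d < n → d ∣ n → Congruent (G f n a) zeroₚ (xPowMinusOne d)))
      × (∀ (b : Pol) → DegLt b n → Congruent b a (Φ n)
           → (∀ d → 1 ≤ d → d < n → d ∣ n → Congruent b zeroₚ (xPowMinusOne d))
           → b ≈ₚ G f n a)
theorem3p8 K f hom Φ cyc (suc n') a =
  (G-degree a , toCongruent (G≡a a) , G-vanishes a) , G-unique a
  where open CharacterisationOfG K f hom Φ cyc n'
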